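{- For every $n\ge 11$ with $n\equiv 2\pmod 3$, the graph $F_n^*$ is $1$-critical.
   Context: For $n\ge 11$, $F_n^*$ is the tree obtained from the path $v_0v_1\cdots v_{n-7}$ by attaching two new pendant vertices to each of $v_1,v_2,v_{n-8}$ (so $F_n^*$ has $n$ vertices). $\mu(G,x)=\sum_k(-1)^kp_G(k)x^{n-2k}$ is the matching polynomial ($p_G(k)$ = number of $k$-edge matchings), $m(1,G)$ the multiplicity of $1$ as a root, $G\setminus u$ the graph with vertex $u$ deleted. A graph $G$ is $1$-critical if $1$ is a root of $\mu(G,x)$ and every vertex $u$ satisfies $m(1,G\setminus u)=m(1,G)-1$. -}

module Defs where

open import Data.Nat as ℕ using (ℕ; zero; suc; _∸_; _/_)
open import Data.Integer as ℤ using (ℤ; +_; -_; _+_; _-_; _*_)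
open import Data.Fin as Fin using (Fin; punchOut)
open import Data.Bool using (Bool; true; false; _∧_; not; if_then_else_)
open import Data.List as List using (List; []; _∷_; _++_; [_]; length; map; filter; foldr; upTo; replicate)
open import Data.Maybe using (Maybe; just; nothing)
open import Data.Product using (_×_; _,_; Σ)
open import Relation.Nullary using (¬_; yes; no)
open import Relation.Nullary.Decidable using (⌊_⌋)
open import Relation.Binary.PropositionalEquality using (_≡_)

-- Graphs: a (simple) graph on the vertex set Fin n, given by its list
-- of edges (each edge an unordered pair, stored once, no loops).

Graph : ℕ → Set
Graph n = List (Fin n × Fin n)

relabel : ∀ {n} → Fin (suc n) → Fin (suc n) → Maybe (Fin n)
relabel u v with u Fin.≟ v
... | yes _ = nothing
... | no u≢v = just (punchOut u≢v)

deleteVertex : ∀ {n} → Graph (suc n) → Fin (suc n) → Graph n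
deleteVertex [] u = []
deleteVertex ((a , b) ∷ es) u with relabel u a | relabel u b
... | just a' | just b' = (a' , b') ∷ deleteVertex es u
... | _       | _       = deleteVertex es u

_==_ : ∀ {n} → Fin n → Fin n → Bool
a == b = ⌊ a Fin.≟ b ⌋

disjointEdges : ∀ {n} → Fin n × Fin n → Fin n × Fin n → Bool
disjointEdges (a , b) (c , d) =
  not (a == c) ∧ not (a == d) ∧ not (b == c) ∧ not (b == d)

allB : ∀ {A : Set} → (A → Bool) → List A → Bool
allB p [] = true
allB p (x ∷ xs) = p x ∧ allB p xs

isMatching : ∀ {n} → List (Fin n × Fin n) → Bool
isMatching [] = true
isMatching (e ∷ es) = allB (disjointEdges e) es ∧ isMatching es

sublists : ∀ {A : Set} → List A → List (List A)
sublists [] = [] ∷ []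
sublists (x ∷ xs) = let s = sublists xs in s ++ map (x ∷_) s

countB : ∀ {A : Set} → (A → Bool) → List A → ℕ
countB p [] = 0
countB p (x ∷ xs) = if p x then suc (countB p xs) else countB p xs

numMatchings : ∀ {n} → Graph n → ℕ → ℕ
numMatchings G k =
  countB (λ s → ⌊ length s ℕ.≟ k ⌋ ∧ isMatching s) (sublists G)

-- Integer polynomials as coefficient lists (constant term first).

Poly : Set
Poly = List ℤ

coeff : Poly → ℕ → ℤ
coeff [] i = + 0
coeff (c ∷ p) zero = c
coeff (c ∷ p) (suc i) = coeff p i

_≈P_ : Poly → Poly → Set
p ≈P q = ∀ i → coeff p i ≡ coeff q i

addP : Poly → Poly → Poly
addP [] q = q
addP p [] = p
addP (a ∷ p) (b ∷ q) = (a + b) ∷ addP p q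

negP : Poly → Poly
negP = map (-_)

monomial : ℤ → ℕ → Poly
monomial c e = replicate e (+ 0) ++ [ c ]

mulXm1 : Poly → Poly
mulXm1 q = addP (+ 0 ∷ q) (negP q)

mulXm1^ : ℕ → Poly → Poly
mulXm1^ zero q = q
mulXm1^ (suc k) q = mulXm1 (mulXm1^ k q)

evalAt1 : Poly → ℤ
evalAt1 = foldr _+_ (+ 0)

RootMult1 : Poly → ℕ → Set
RootMult1 p k = Σ Poly (λ q → (p ≈P mulXm1^ k q) × ¬ (evalAt1 q ≡ + 0))

sign : ℕ → ℤ
sign zero = + 1
sign (suc k) = - sign k

matchingPoly : ∀ {n} → Graph n → Poly
matchingPoly {n} G =
  foldr addP []
    (map (λ k → monomial (sign k * + numMatchings G k) (n ∸ (2 ℕ.* k)))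
         (upTo (suc (n / 2))))

-- 1-critical graphs (on a nonempty vertex set): 1 is a root of μ(G,x),
-- of multiplicity m ≥ 1 say, and every G \ u has m(1, G \ u) = m - 1.

OneCritical : ∀ {n} → Graph (suc n) → Set
OneCritical G =
  Σ ℕ (λ m → RootMult1 (matchingPoly G) (suc m) ×
             (∀ u → RootMult1 (matchingPoly (deleteVertex G u)) m))

-- The tree F_n^*.  Vertices 0,...,n-7 are the path v_0 ... v_{n-7};
-- vertices n-6, n-5 are pendant at v_1, n-4, n-3 pendant at v_2 and
-- n-2, n-1 pendant at v_{n-8}.

-- natural number to Fin (suc m) (saturating; only used for i ≤ m)
toFin : ∀ m → ℕ → Fin (suc m)
toFin zero i = Fin.zero
toFin (suc m) zero = Fin.zero
toFin (suc m) (suc i) = Fin.suc (toFin m i)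

FstarEdgesℕ : ℕ → List (ℕ × ℕ)
FstarEdgesℕ n =
  map (λ i → (i , suc i)) (upTo (n ∸ 7)) ++
  ( (1 , n ∸ 6) ∷ (1 , n ∸ 5) ∷ (2 , n ∸ 4) ∷ (2 , n ∸ 3)
  ∷ (n ∸ 8 , n ∸ 2) ∷ (n ∸ 8 , n ∸ 1) ∷ [])

Fstar : (n : ℕ) → Graph n
Fstar zero = []
Fstar (suc m) = map (λ { (a , b) → (toFin m a , toFin m b) }) (FstarEdgesℕ (suc m))

-- Over the matchings M of G, μ(G,1) = Σ_M (-1)^|M| =: μ₁ G and μ′(G,1) = n μ₁ G − 2 ν₁ G with
-- ν₁ G = Σ_M (-1)^|M| |M|.  So G is 1-critical, with m(1,G) = 1, as soon as μ₁ G = 0, ν₁ G ≠ 0 and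
-- μ₁ (G ∖ u) ≠ 0 for every vertex u.  F*_{n+3} is F*_n with a path edge v_k v_{k+1} subdivided by
-- three new vertices.  Expanding along the new path with the recurrence
-- μ₁ (e ∷ R) = μ₁ R − μ₁ (R without the edges meeting e) shows that the subdivision negates μ₁,
-- also after deleting a vertex off the new path, and yields a linear recurrence for ν₁.  Hence the
-- sign pattern recorded in Invariant propagates from n = 11, 14, 17, where it is checked by
-- computation, to every n ≡ 2 (mod 3).

module Submission where

open import Algebra.Bundles using (CommutativeMonoid)
open import Data.Bool using (Bool; true; false; _∧_; not; T; T?; if_then_else_)
open import Data.Bool.Properties using (T-≡; T-∧; ∧-assoc; ∧-commutativeMonoid; ∧-zeroʳ; ∧-identityʳ)
open import Data.Empty using (⊥-elim)
open import Data.Fin as Fin using (Fin; toℕ; punchOut)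
open import Data.Fin.Properties using (toℕ<n; punchOut-injective; punchOut-cong)
open import Data.Integer as ℤ using (ℤ; +_; -_; _+_; _-_; _*_)
import Data.Integer.Properties as ℤ
open import Data.Integer.Tactic.RingSolver using (solve-∀)
import Data.Nat.Tactic.RingSolver as ℕ-Solver
open import Data.List using (List; []; _∷_; _++_; map; foldr; length; filterᵇ; applyUpTo; upTo)
open import Data.List.Properties
  using (++-assoc; ++-identityʳ; map-++; map-applyUpTo; upTo-∷ʳ; length-filter; filter-++; filter-all; filter-accept; filter-reject)
open import Data.List.Relation.Binary.Permutation.Propositional as ↭ using (_↭_; prep; swap)
open import Data.List.Relation.Binary.Permutation.Propositional.Properties using (shift; shifts)
open import Data.List.Relation.Binary.Pointwise as Pointwise using (Pointwise; []; _∷_; Pointwise-length)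
open import Data.List.Relation.Unary.All as All using (All; []; _∷_)
open import Data.List.Relation.Unary.All.Properties using (++⁺; filter⁺; gmap⁺; map⁺)
open import Data.List.Relation.Unary.Unique.Propositional using (Unique; []; _∷_)
open import Data.Nat as ℕ using (ℕ; zero; suc; _≤_; _<_; z≤n; s≤s; _%_)
import Data.Nat.Properties as ℕ
open import Data.Nat.DivMod using (m≡m%n+[m/n]*n; m*n/n≡m; /-monoˡ-≤)
open import Data.Product using (Σ; _×_; _,_; proj₁; proj₂)
open import Data.Sum using (_⊎_; inj₁; inj₂)
open import Data.Unit using (tt)
open import Function using (_∘_; _∘′_; _⇔_; mk⇔; Equivalence)
open import Relation.Nullary using (Dec; yes; no; ¬_; contradiction; _×-dec_)
open import Relation.Nullary.Decidable using (⌊_⌋; from-yes; dec-true; dec-false; does-⇔; isYes≗does)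
open import Relation.Binary.PropositionalEquality
open import Defs

open import Algebra.Properties.CommutativeSemigroup (CommutativeMonoid.commutativeSemigroup ∧-commutativeMonoid)
  using () renaming (interchange to ∧-interchange; xy∙z≈xz∙y to ∧-right-comm)
open import Algebra.Properties.CommutativeSemigroup ℤ.+-commutativeSemigroup
  using () renaming (interchange to +-interchange; xy∙z≈xz∙y to +-right-comm)

sumBy : {A : Set} → (A → ℤ) → List A → ℤ
sumBy f [] = + 0
sumBy f (x ∷ xs) = f x + sumBy f xs

module _ {A : Set} where

  sumBy-++ : ∀ (f : A → ℤ) xs ys → sumBy f (xs ++ ys) ≡ sumBy f xs + sumBy f ys
  sumBy-++ f [] ys = sym (ℤ.+-identityˡ _)
  sumBy-++ f (x ∷ xs) ys = trans (cong (_+_ (f x)) (sumBy-++ f xs ys)) (sym (ℤ.+-assoc (f x) _ _))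

  sumBy-cong : ∀ {f f' : A → ℤ} → (∀ x → f x ≡ f' x) → ∀ xs → sumBy f xs ≡ sumBy f' xs
  sumBy-cong f≗f' [] = refl
  sumBy-cong f≗f' (x ∷ xs) = cong₂ _+_ (f≗f' x) (sumBy-cong f≗f' xs)

  sumBy-zero : ∀ {f : A → ℤ} → (∀ x → f x ≡ + 0) → ∀ xs → sumBy f xs ≡ + 0
  sumBy-zero f≗0 [] = refl
  sumBy-zero f≗0 (x ∷ xs) = cong₂ _+_ (f≗0 x) (sumBy-zero f≗0 xs)

  sumBy-cong-All : ∀ {P : A → Set} {f f' : A → ℤ} → (∀ x → P x → f x ≡ f' x) → ∀ {xs} → All P xs → sumBy f xs ≡ sumBy f' xs
  sumBy-cong-All f≈f' [] = refl
  sumBy-cong-All f≈f' (px ∷ pxs) = cong₂ _+_ (f≈f' _ px) (sumBy-cong-All f≈f' pxs)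

  sumBy-+ : ∀ (f f' : A → ℤ) xs → sumBy (λ x → f x + f' x) xs ≡ sumBy f xs + sumBy f' xs
  sumBy-+ f f' [] = refl
  sumBy-+ f f' (x ∷ xs) rewrite sumBy-+ f f' xs = +-interchange (f x) (f' x) (sumBy f xs) (sumBy f' xs)

  sumBy-* : ∀ c (f : A → ℤ) xs → sumBy (λ x → c * f x) xs ≡ c * sumBy f xs
  sumBy-* c f [] = sym (ℤ.*-zeroʳ c)
  sumBy-* c f (x ∷ xs) rewrite sumBy-* c f xs = sym (ℤ.*-distribˡ-+ c (f x) (sumBy f xs))

  sumBy-filterᵇ : ∀ (f : A → ℤ) p xs → sumBy f (filterᵇ p xs) ≡ sumBy (λ x → if p x then f x else + 0) xs
  sumBy-filterᵇ f p [] = refl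
  sumBy-filterᵇ f p (x ∷ xs) with p x
  ... | true = cong (_+_ (f x)) (sumBy-filterᵇ f p xs)
  ... | false = trans (sumBy-filterᵇ f p xs) (sym (ℤ.+-identityˡ _))

sumBy-map : ∀ {A B : Set} (f : B → ℤ) (h : A → B) xs → sumBy f (map h xs) ≡ sumBy (f ∘ h) xs
sumBy-map f h [] = refl
sumBy-map f h (x ∷ xs) = cong (_+_ (f (h x))) (sumBy-map f h xs)

filterᵇ-map : ∀ {A B : Set} (p : B → Bool) (f : A → B) xs → filterᵇ p (map f xs) ≡ map f (filterᵇ (p ∘ f) xs)
filterᵇ-map p f [] = refl
filterᵇ-map p f (x ∷ xs) with p (f x)
... | true = cong (f x ∷_) (filterᵇ-map p f xs)
... | false = filterᵇ-map p f xs

module _ {A : Set} where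

  filterᵇ-filterᵇ : ∀ (p q : A → Bool) xs → filterᵇ q (filterᵇ p xs) ≡ filterᵇ (λ z → p z ∧ q z) xs
  filterᵇ-filterᵇ p q [] = refl
  filterᵇ-filterᵇ p q (x ∷ xs) with p x
  ... | false = filterᵇ-filterᵇ p q xs
  ... | true with q x
  ...   | true = cong (x ∷_) (filterᵇ-filterᵇ p q xs)
  ...   | false = filterᵇ-filterᵇ p q xs

  filterᵇ-∷ : ∀ (p : A → Bool) x xs → filterᵇ p (x ∷ xs) ≡ (if p x then x ∷ filterᵇ p xs else filterᵇ p xs)
  filterᵇ-∷ p x xs with p x
  ... | true = refl
  ... | false = refl

  filterᵇ-cong : ∀ {p q : A → Bool} → (∀ z → p z ≡ q z) → ∀ xs → filterᵇ p xs ≡ filterᵇ q xs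
  filterᵇ-cong p≗q [] = refl
  filterᵇ-cong {p} {q} p≗q (x ∷ xs) rewrite p≗q x with q x
  ... | true = cong (x ∷_) (filterᵇ-cong p≗q xs)
  ... | false = filterᵇ-cong p≗q xs

  filterᵇ-cong-All : ∀ {P : A → Set} {p q : A → Bool} → (∀ z → P z → p z ≡ q z) →
                     ∀ {xs} → All P xs → filterᵇ p xs ≡ filterᵇ q xs
  filterᵇ-cong-All p≗q [] = refl
  filterᵇ-cong-All {q = q} p≗q {x ∷ xs} (px ∷ pxs) rewrite p≗q x px with q x
  ... | true = cong (x ∷_) (filterᵇ-cong-All p≗q pxs)
  ... | false = filterᵇ-cong-All p≗q pxs

  filterᵇ-const-true : ∀ (xs : List A) → filterᵇ (λ _ → true) xs ≡ xs
  filterᵇ-const-true [] = refl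
  filterᵇ-const-true (x ∷ xs) = cong (x ∷_) (filterᵇ-const-true xs)

  filterᵇ-allB-map-∷-accept : ∀ (p : A → Bool) x yss → p x ≡ true →
    filterᵇ (allB p) (map (x ∷_) yss) ≡ map (x ∷_) (filterᵇ (allB p) yss)
  filterᵇ-allB-map-∷-accept p x [] px = refl
  filterᵇ-allB-map-∷-accept p x (ys ∷ yss) px rewrite px with allB p ys
  ... | true = cong ((x ∷ ys) ∷_) (filterᵇ-allB-map-∷-accept p x yss px)
  ... | false = filterᵇ-allB-map-∷-accept p x yss px

  filterᵇ-allB-map-∷-reject : ∀ (p : A → Bool) x yss → p x ≡ false →
    filterᵇ (allB p) (map (x ∷_) yss) ≡ []
  filterᵇ-allB-map-∷-reject p x [] px = refl
  filterᵇ-allB-map-∷-reject p x (ys ∷ yss) px rewrite px = filterᵇ-allB-map-∷-reject p x yss px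

  sublists-filterᵇ : ∀ (p : A → Bool) xs → sublists (filterᵇ p xs) ≡ filterᵇ (allB p) (sublists xs)
  sublists-filterᵇ p [] = refl
  sublists-filterᵇ p (x ∷ xs) with p x in px
  ... | true = begin
      sublists (filterᵇ p xs) ++ map (x ∷_) (sublists (filterᵇ p xs))
        ≡⟨ cong (λ s → s ++ map (x ∷_) s) (sublists-filterᵇ p xs) ⟩
      F ++ map (x ∷_) F
        ≡⟨ cong (F ++_) (sym (filterᵇ-allB-map-∷-accept p x (sublists xs) px)) ⟩
      F ++ filterᵇ (allB p) (map (x ∷_) (sublists xs))
        ≡⟨ sym (filter-++ _ (sublists xs) _) ⟩
      filterᵇ (allB p) (sublists xs ++ map (x ∷_) (sublists xs)) ∎
    where open ≡-Reasoning
          F = filterᵇ (allB p) (sublists xs)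
  ... | false = begin
      sublists (filterᵇ p xs)
        ≡⟨ sublists-filterᵇ p xs ⟩
      F
        ≡⟨ sym (++-identityʳ F) ⟩
      F ++ []
        ≡⟨ cong (F ++_) (sym (filterᵇ-allB-map-∷-reject p x (sublists xs) px)) ⟩
      F ++ filterᵇ (allB p) (map (x ∷_) (sublists xs))
        ≡⟨ sym (filter-++ _ (sublists xs) _) ⟩
      filterᵇ (allB p) (sublists xs ++ map (x ∷_) (sublists xs)) ∎
    where open ≡-Reasoning
          F = filterᵇ (allB p) (sublists xs)

signedSize : ℕ → ℤ
signedSize k = sign k * + k

pairwiseᵇ : {A : Set} → (A → A → Bool) → List A → Bool
pairwiseᵇ d [] = true
pairwiseᵇ d (x ∷ xs) = allB (d x) xs ∧ pairwiseᵇ d xs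

module _ {A : Set} (d : A → A → Bool) where

  matchingWeight : (ℕ → ℤ) → List A → ℤ
  matchingWeight g s = if pairwiseᵇ d s then g (length s) else + 0

  matchingSum : (ℕ → ℤ) → List A → ℤ
  matchingSum g xs = sumBy (matchingWeight g) (sublists xs)

  matchingSum-∷ : ∀ g x xs →
    matchingSum g (x ∷ xs) ≡ matchingSum g xs + matchingSum (g ∘ suc) (filterᵇ (d x) xs)
  matchingSum-∷ g x xs = begin
      sumBy (matchingWeight g) (sublists xs ++ map (x ∷_) (sublists xs))
        ≡⟨ sumBy-++ (matchingWeight g) (sublists xs) _ ⟩
      matchingSum g xs + sumBy (matchingWeight g) (map (x ∷_) (sublists xs))
        ≡⟨ cong (_+_ (matchingSum g xs)) (sumBy-map (matchingWeight g) (x ∷_) (sublists xs)) ⟩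
      matchingSum g xs + sumBy (matchingWeight g ∘ (x ∷_)) (sublists xs)
        ≡⟨ cong (_+_ (matchingSum g xs)) (sumBy-cong extend (sublists xs)) ⟩
      matchingSum g xs + sumBy (λ s → if allB (d x) s then matchingWeight (g ∘ suc) s else + 0) (sublists xs)
        ≡⟨ cong (_+_ (matchingSum g xs)) (sym (sumBy-filterᵇ (matchingWeight (g ∘ suc)) (allB (d x)) (sublists xs))) ⟩
      matchingSum g xs + sumBy (matchingWeight (g ∘ suc)) (filterᵇ (allB (d x)) (sublists xs))
        ≡⟨ cong (λ ss → matchingSum g xs + sumBy (matchingWeight (g ∘ suc)) ss) (sym (sublists-filterᵇ (d x) xs)) ⟩
      matchingSum g xs + matchingSum (g ∘ suc) (filterᵇ (d x) xs) ∎
    where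
      open ≡-Reasoning
      extend : ∀ s → matchingWeight g (x ∷ s) ≡ (if allB (d x) s then matchingWeight (g ∘ suc) s else + 0)
      extend s with allB (d x) s
      ... | true = refl
      ... | false = refl

  matchingSum-cong : ∀ {g h} → (∀ k → g k ≡ h k) → ∀ xs → matchingSum g xs ≡ matchingSum h xs
  matchingSum-cong {g} {h} g≗h xs = sumBy-cong weight (sublists xs)
    where
      weight : ∀ s → matchingWeight g s ≡ matchingWeight h s
      weight s with pairwiseᵇ d s
      ... | true = g≗h (length s)
      ... | false = refl

  matchingSum-+ : ∀ {g h h'} → (∀ k → g k ≡ h k + h' k) → ∀ xs →
                  matchingSum g xs ≡ matchingSum h xs + matchingSum h' xs
  matchingSum-+ {g} {h} {h'} g≗h+h' xs =
    trans (sumBy-cong weight (sublists xs)) (sumBy-+ (matchingWeight h) (matchingWeight h') (sublists xs))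
    where
      weight : ∀ s → matchingWeight g s ≡ matchingWeight h s + matchingWeight h' s
      weight s with pairwiseᵇ d s
      ... | true = g≗h+h' (length s)
      ... | false = refl

  matchingSum-* : ∀ c {g h} → (∀ k → g k ≡ c * h k) → ∀ xs → matchingSum g xs ≡ c * matchingSum h xs
  matchingSum-* c {g} {h} g≗c*h xs =
    trans (sumBy-cong weight (sublists xs)) (sumBy-* c (matchingWeight h) (sublists xs))
    where
      weight : ∀ s → matchingWeight g s ≡ c * matchingWeight h s
      weight s with pairwiseᵇ d s
      ... | true = g≗c*h (length s)
      ... | false = sym (ℤ.*-zeroʳ c)

module _ {A : Set} (d : A → A → Bool) (d-sym : ∀ x y → d x y ≡ d y x) where

  private
    S = matchingSum d

    -- A permutation step must be transported through the filtered tails produced by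
    -- matchingSum-∷, so invariance is proved for all filters at once.
    SameFilteredSums : List A → List A → Set
    SameFilteredSums xs ys = ∀ p g → S g (filterᵇ p xs) ≡ S g (filterᵇ p ys)

    prepend : ∀ {xs ys} → SameFilteredSums xs ys → ∀ p g x →
              S g (x ∷ filterᵇ p xs) ≡ S g (x ∷ filterᵇ p ys)
    prepend {xs} {ys} same p g x = begin
        S g (x ∷ filterᵇ p xs)
          ≡⟨ matchingSum-∷ d g x (filterᵇ p xs) ⟩
        S g (filterᵇ p xs) + S (g ∘ suc) (filterᵇ (d x) (filterᵇ p xs))
          ≡⟨ cong₂ _+_ (same p g) (cong (S (g ∘ suc)) (filterᵇ-filterᵇ p (d x) xs)) ⟩
        S g (filterᵇ p ys) + S (g ∘ suc) (filterᵇ (λ z → p z ∧ d x z) xs)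
          ≡⟨ cong (_+_ (S g (filterᵇ p ys))) (same _ (g ∘ suc)) ⟩
        S g (filterᵇ p ys) + S (g ∘ suc) (filterᵇ (λ z → p z ∧ d x z) ys)
          ≡⟨ cong (_+_ (S g (filterᵇ p ys))) (cong (S (g ∘ suc)) (sym (filterᵇ-filterᵇ p (d x) ys))) ⟩
        S g (filterᵇ p ys) + S (g ∘ suc) (filterᵇ (d x) (filterᵇ p ys))
          ≡⟨ sym (matchingSum-∷ d g x (filterᵇ p ys)) ⟩
        S g (x ∷ filterᵇ p ys) ∎
      where open ≡-Reasoning

    prepend₂-expansion : A → A → (A → Bool) → (ℕ → ℤ) → List A → ℤ
    prepend₂-expansion x y p g zs =
      S g (filterᵇ p zs) + S (g ∘ suc) (filterᵇ (λ z → p z ∧ d y z) zs) +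
      (if d x y
        then S (g ∘ suc) (filterᵇ (λ z → p z ∧ d x z) zs)
             + S (g ∘ suc ∘ suc) (filterᵇ (λ z → (p z ∧ d x z) ∧ d y z) zs)
        else S (g ∘ suc) (filterᵇ (λ z → p z ∧ d x z) zs))

    prepend₂ : ∀ x y p g zs → S g (x ∷ y ∷ filterᵇ p zs) ≡ prepend₂-expansion x y p g zs
    prepend₂ x y p g zs
      rewrite matchingSum-∷ d g x (y ∷ filterᵇ p zs) | matchingSum-∷ d g y (filterᵇ p zs)
            | filterᵇ-filterᵇ p (d y) zs
      with d x y
    ... | true rewrite matchingSum-∷ d (g ∘ suc) y (filterᵇ (d x) (filterᵇ p zs))
                     | filterᵇ-filterᵇ p (d x) zs | filterᵇ-filterᵇ (λ z → p z ∧ d x z) (d y) zs = refl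
    ... | false rewrite filterᵇ-filterᵇ p (d x) zs = refl

    prepend₂-expansion-cong : ∀ {xs ys} → SameFilteredSums xs ys → ∀ x y p g →
                              prepend₂-expansion x y p g xs ≡ prepend₂-expansion x y p g ys
    prepend₂-expansion-cong same x y p g with d x y
    ... | true = cong₂ _+_ (cong₂ _+_ (same p g) (same _ (g ∘ suc)))
                           (cong₂ _+_ (same _ (g ∘ suc)) (same _ (g ∘ suc ∘ suc)))
    ... | false = cong₂ _+_ (cong₂ _+_ (same p g) (same _ (g ∘ suc))) (same _ (g ∘ suc))

    prepend₂-expansion-swap : ∀ x y p g zs → prepend₂-expansion x y p g zs ≡ prepend₂-expansion y x p g zs
    prepend₂-expansion-swap x y p g zs rewrite d-sym x y with d y x
    ... | true rewrite filterᵇ-cong (λ z → ∧-right-comm (p z) (d x z) (d y z)) zs =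
      +-interchange (S g (filterᵇ p zs)) _ _ _
    ... | false = +-right-comm (S g (filterᵇ p zs)) _ _

  matchingSum-filterᵇ-↭ : ∀ {xs ys} → xs ↭ ys → ∀ p g →
                          matchingSum d g (filterᵇ p xs) ≡ matchingSum d g (filterᵇ p ys)
  matchingSum-filterᵇ-↭ ↭.refl p g = refl
  matchingSum-filterᵇ-↭ (↭.trans xs↭ys ys↭zs) p g = trans (matchingSum-filterᵇ-↭ xs↭ys p g) (matchingSum-filterᵇ-↭ ys↭zs p g)
  matchingSum-filterᵇ-↭ (prep {xs = xs} {ys = ys} x xs↭ys) p g with p x
  ... | true = prepend {xs} {ys} (matchingSum-filterᵇ-↭ xs↭ys) p g x
  ... | false = matchingSum-filterᵇ-↭ xs↭ys p g
  matchingSum-filterᵇ-↭ (swap {xs = xs} {ys = ys} x y xs↭ys) p g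
    rewrite filterᵇ-∷ p x (y ∷ xs) | filterᵇ-∷ p y xs | filterᵇ-∷ p y (x ∷ ys) | filterᵇ-∷ p x ys
    with p x | p y
  ... | true | true = begin
      S g (x ∷ y ∷ filterᵇ p xs)       ≡⟨ prepend₂ x y p g xs ⟩
      prepend₂-expansion x y p g xs    ≡⟨ prepend₂-expansion-cong {xs} {ys} (matchingSum-filterᵇ-↭ xs↭ys) x y p g ⟩
      prepend₂-expansion x y p g ys    ≡⟨ prepend₂-expansion-swap x y p g ys ⟩
      prepend₂-expansion y x p g ys    ≡⟨ sym (prepend₂ y x p g ys) ⟩
      S g (y ∷ x ∷ filterᵇ p ys)       ∎
    where open ≡-Reasoning
  ... | true | false = prepend {xs} {ys} (matchingSum-filterᵇ-↭ xs↭ys) p g x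
  ... | false | true = prepend {xs} {ys} (matchingSum-filterᵇ-↭ xs↭ys) p g y
  ... | false | false = matchingSum-filterᵇ-↭ xs↭ys p g

  matchingSum-↭ : ∀ {xs ys} → xs ↭ ys → ∀ g → matchingSum d g xs ≡ matchingSum d g ys
  matchingSum-↭ {xs} {ys} xs↭ys g =
    subst₂ (λ xs′ ys′ → S g xs′ ≡ S g ys′) (filterᵇ-const-true xs) (filterᵇ-const-true ys)
           (matchingSum-filterᵇ-↭ xs↭ys (λ _ → true) g)

sumBy-pointwise : ∀ {A B : Set} {R : A → B → Set} {f : A → ℤ} {f' : B → ℤ} →
                  (∀ {x y} → R x y → f x ≡ f' y) → ∀ {xs ys} → Pointwise R xs ys → sumBy f xs ≡ sumBy f' ys
sumBy-pointwise f≈f' [] = refl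
sumBy-pointwise f≈f' (r ∷ rs) = cong₂ _+_ (f≈f' r) (sumBy-pointwise f≈f' rs)

sublists⁺ : ∀ {A B : Set} {R : A → B → Set} {xs ys} →
            Pointwise R xs ys → Pointwise (Pointwise R) (sublists xs) (sublists ys)
sublists⁺ [] = [] ∷ []
sublists⁺ (r ∷ rs) =
  Pointwise.++⁺ (sublists⁺ rs) (Pointwise.map⁺ _ _ (Pointwise.map (r ∷_) (sublists⁺ rs)))

module _ {A B : Set} {R : A → B → Set} (dA : A → A → Bool) (dB : B → B → Bool)
         (d-resp : ∀ {x y x' y'} → R x y → R x' y' → dA x x' ≡ dB y y') where

  private
    allB⁺ : ∀ {x y} → R x y → ∀ {xs ys} → Pointwise R xs ys → allB (dA x) xs ≡ allB (dB y) ys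
    allB⁺ r [] = refl
    allB⁺ r (r' ∷ rs) = cong₂ _∧_ (d-resp r r') (allB⁺ r rs)

    pairwiseᵇ⁺ : ∀ {xs ys} → Pointwise R xs ys → pairwiseᵇ dA xs ≡ pairwiseᵇ dB ys
    pairwiseᵇ⁺ [] = refl
    pairwiseᵇ⁺ (r ∷ rs) = cong₂ _∧_ (allB⁺ r rs) (pairwiseᵇ⁺ rs)

  matchingSum-pointwise : ∀ g {xs ys} → Pointwise R xs ys → matchingSum dA g xs ≡ matchingSum dB g ys
  matchingSum-pointwise g xs~ys = sumBy-pointwise weight (sublists⁺ xs~ys)
    where
      weight : ∀ {s t} → Pointwise R s t → matchingWeight dA g s ≡ matchingWeight dB g t
      weight {s} {t} s~t rewrite pairwiseᵇ⁺ s~t | Pointwise-length s~t = refl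

matchingSum-map : ∀ {A B : Set} {P : A → Set} (dA : A → A → Bool) (dB : B → B → Bool) (f : A → B) →
                  (∀ {x y} → P x → P y → dB (f x) (f y) ≡ dA x y) →
                  ∀ g {xs} → All P xs → matchingSum dB g (map f xs) ≡ matchingSum dA g xs
matchingSum-map {P = P} dA dB f d-resp g pxs =
  sym (matchingSum-pointwise {R = λ x y → P x × f x ≡ y} dA dB
         (λ { (px , refl) (py , refl) → sym (d-resp px py) }) g (graph pxs))
  where
    graph : ∀ {xs} → All P xs → Pointwise (λ x y → P x × f x ≡ y) xs (map f xs)
    graph [] = []
    graph (px ∷ pxs) = (px , refl) ∷ graph pxs

Edge : Set
Edge = ℕ × ℕ

avoids : ℕ → Edge → Bool
avoids u (a , b) = not (u ℕ.≡ᵇ a) ∧ not (u ℕ.≡ᵇ b)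

disjoint : Edge → Edge → Bool
disjoint (a , b) e = avoids a e ∧ avoids b e

infixl 6 _∖_
_∖_ : List Edge → ℕ → List Edge
R ∖ u = filterᵇ (avoids u) R

Fresh : ℕ → List Edge → Set
Fresh v R = All (T ∘ avoids v) R

≡ᵇ-sym : ∀ m n → (m ℕ.≡ᵇ n) ≡ (n ℕ.≡ᵇ m)
≡ᵇ-sym m n = does-⇔ (mk⇔ sym sym) (m ℕ.≟ n) (n ℕ.≟ m)

disjoint-sym : ∀ e f → disjoint e f ≡ disjoint f e
disjoint-sym (a , b) (c , d) rewrite ≡ᵇ-sym a c | ≡ᵇ-sym a d | ≡ᵇ-sym b c | ≡ᵇ-sym b d =
  ∧-interchange (not (c ℕ.≡ᵇ a)) (not (d ℕ.≡ᵇ a)) (not (c ℕ.≡ᵇ b)) (not (d ℕ.≡ᵇ b))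

avoids-≢ : ∀ {u a b} → u ≢ a → u ≢ b → avoids u (a , b) ≡ true
avoids-≢ {u} {a} {b} u≢a u≢b rewrite dec-false (u ℕ.≟ a) u≢a | dec-false (u ℕ.≟ b) u≢b = refl

avoids-endˡ : ∀ a b → avoids a (a , b) ≡ false
avoids-endˡ a b rewrite dec-true (a ℕ.≟ a) refl = refl

avoids-endʳ : ∀ a b → avoids b (a , b) ≡ false
avoids-endʳ a b rewrite dec-true (b ℕ.≟ b) refl with b ℕ.≡ᵇ a
... | true = refl
... | false = refl

private
  T⇒≡true : ∀ {b} → T b → b ≡ true
  T⇒≡true = Equivalence.to T-≡

filterᵇ-disjoint-freshˡ : ∀ x y {R} → Fresh x R → filterᵇ (disjoint (x , y)) R ≡ R ∖ y
filterᵇ-disjoint-freshˡ x y = filterᵇ-cong-All (λ e x∉e → cong (_∧ avoids y e) (T⇒≡true x∉e))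

filterᵇ-disjoint-freshʳ : ∀ x y {R} → Fresh y R → filterᵇ (disjoint (x , y)) R ≡ R ∖ x
filterᵇ-disjoint-freshʳ x y = filterᵇ-cong-All (λ e y∉e → trans (cong (avoids x e ∧_) (T⇒≡true y∉e)) (∧-identityʳ _))

filterᵇ-disjoint-fresh : ∀ x y {R} → Fresh x R → Fresh y R → filterᵇ (disjoint (x , y)) R ≡ R
filterᵇ-disjoint-fresh x y x∉R y∉R =
  filter-all (T? ∘ _) (All.zipWith (Equivalence.from T-∧) (x∉R , y∉R))

μ₁ ν₁ : List Edge → ℤ
μ₁ = matchingSum disjoint sign
ν₁ = matchingSum disjoint signedSize

private
  S = matchingSum disjoint

sign-suc : ∀ R → S (sign ∘ suc) R ≡ - μ₁ R
sign-suc R = trans (matchingSum-* disjoint (ℤ.-[1+ 0 ]) {h = sign} (λ k → sym (ℤ.-1*i≡-i (sign k))) R) (ℤ.-1*i≡-i _)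

sign-suc-suc : ∀ R → S (sign ∘ suc ∘ suc) R ≡ μ₁ R
sign-suc-suc = matchingSum-cong disjoint (λ k → ℤ.neg-involutive (sign k))

signedSize-suc : ∀ R → S (signedSize ∘ suc) R ≡ - ν₁ R - μ₁ R
signedSize-suc R =
  trans (matchingSum-+ disjoint {h = λ k → ℤ.-[1+ 0 ] * signedSize k} {h' = λ k → ℤ.-[1+ 0 ] * sign k} split R)
        (cong₂ _+_ (trans (matchingSum-* disjoint ℤ.-[1+ 0 ] {h = signedSize} (λ _ → refl) R) (ℤ.-1*i≡-i _))
                   (trans (matchingSum-* disjoint ℤ.-[1+ 0 ] {h = sign} (λ _ → refl) R) (ℤ.-1*i≡-i _)))
  where
    split : ∀ k → signedSize (suc k) ≡ ℤ.-[1+ 0 ] * signedSize k + ℤ.-[1+ 0 ] * sign k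
    split k = trans (cong (- sign k *_) (sym (ℤ.pos-+ 1 k))) (identity (sign k) (+ k))
      where identity : ∀ s k → - s * (+ 1 + k) ≡ ℤ.-[1+ 0 ] * (s * k) + ℤ.-[1+ 0 ] * s
            identity = solve-∀

signedSize-suc-suc : ∀ R → S (signedSize ∘ suc ∘ suc) R ≡ ν₁ R + + 2 * μ₁ R
signedSize-suc-suc R =
  trans (matchingSum-+ disjoint {h = signedSize} {h' = λ k → + 2 * sign k} split R)
        (cong (_+_ (ν₁ R)) (matchingSum-* disjoint (+ 2) {h = sign} (λ _ → refl) R))
  where
    split : ∀ k → signedSize (suc (suc k)) ≡ signedSize k + + 2 * sign k
    split k = trans (cong (- - sign k *_) (sym (ℤ.pos-+ 2 k))) (identity (sign k) (+ k))
      where identity : ∀ s k → - - s * (+ 2 + k) ≡ s * k + + 2 * s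
            identity = solve-∀

μ₁-∷ : ∀ e R → μ₁ (e ∷ R) ≡ μ₁ R - μ₁ (filterᵇ (disjoint e) R)
μ₁-∷ e R = trans (matchingSum-∷ disjoint sign e R) (cong (_+_ (μ₁ R)) (sign-suc (filterᵇ (disjoint e) R)))

ν₁-∷ : ∀ e R → ν₁ (e ∷ R) ≡ ν₁ R - ν₁ (filterᵇ (disjoint e) R) - μ₁ (filterᵇ (disjoint e) R)
ν₁-∷ e R = trans (matchingSum-∷ disjoint signedSize e R)
                 (trans (cong (_+_ (ν₁ R)) (signedSize-suc (filterᵇ (disjoint e) R))) (sym (ℤ.+-assoc (ν₁ R) _ _)))

matchingSum-path₁ : ∀ g z b R → Fresh z R → S g ((z , b) ∷ R) ≡ S g R + S (g ∘ suc) (R ∖ b)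
matchingSum-path₁ g z b R z∉R =
  trans (matchingSum-∷ disjoint g (z , b) R) (cong (λ R′ → S g R + S (g ∘ suc) R′) (filterᵇ-disjoint-freshˡ z b z∉R))

matchingSum-path₂ : ∀ g {y z} b R → Unique (y ∷ z ∷ b ∷ []) → All (λ v → Fresh v R) (y ∷ z ∷ []) →
  S g ((y , z) ∷ (z , b) ∷ R) ≡ (S g R + S (g ∘ suc) (R ∖ b)) + S (g ∘ suc) R
matchingSum-path₂ g {y} {z} b R ((y≢z ∷ y≢b ∷ []) ∷ _) (y∉R ∷ z∉R ∷ []) =
  trans (matchingSum-∷ disjoint g (y , z) ((z , b) ∷ R)) (cong₂ _+_ (matchingSum-path₁ g z b R z∉R) (cong (S (g ∘ suc)) tail))
  where
    tail : filterᵇ (disjoint (y , z)) ((z , b) ∷ R) ≡ R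
    tail rewrite filterᵇ-∷ (disjoint (y , z)) (z , b) R | avoids-≢ y≢z y≢b | avoids-endˡ z b =
      filterᵇ-disjoint-fresh y z y∉R z∉R

matchingSum-path₃ : ∀ g {x y z} b R → Unique (x ∷ y ∷ z ∷ b ∷ []) → All (λ v → Fresh v R) (x ∷ y ∷ z ∷ []) →
  S g ((x , y) ∷ (y , z) ∷ (z , b) ∷ R) ≡
  ((S g R + S (g ∘ suc) (R ∖ b)) + S (g ∘ suc) R) + (S (g ∘ suc) R + S (g ∘ suc ∘ suc) (R ∖ b))
matchingSum-path₃ g {x} {y} {z} b R ((x≢y ∷ x≢z ∷ x≢b ∷ []) ∷ uniq@((y≢z ∷ y≢b ∷ []) ∷ _)) (x∉R ∷ fresh@(y∉R ∷ z∉R ∷ [])) =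
  trans (matchingSum-∷ disjoint g (x , y) ((y , z) ∷ (z , b) ∷ R))
        (cong₂ _+_ (matchingSum-path₂ g b R uniq fresh)
                   (trans (cong (S (g ∘ suc)) tail) (matchingSum-path₁ (g ∘ suc) z b R z∉R)))
  where
    tail : filterᵇ (disjoint (x , y)) ((y , z) ∷ (z , b) ∷ R) ≡ (z , b) ∷ R
    tail rewrite filterᵇ-∷ (disjoint (x , y)) (y , z) ((z , b) ∷ R) | filterᵇ-∷ (disjoint (x , y)) (z , b) R
               | avoids-≢ x≢y x≢z | avoids-endˡ y z | avoids-≢ x≢z x≢b | avoids-≢ y≢z y≢b =
      cong ((z , b) ∷_) (filterᵇ-disjoint-fresh x y x∉R y∉R)

matchingSum-path₄ : ∀ g a {x y z} b R → Unique (a ∷ x ∷ y ∷ z ∷ b ∷ []) → All (λ v → Fresh v R) (x ∷ y ∷ z ∷ []) →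
  S g ((a , x) ∷ (x , y) ∷ (y , z) ∷ (z , b) ∷ R) ≡
  (((S g R + S (g ∘ suc) (R ∖ b)) + S (g ∘ suc) R) + (S (g ∘ suc) R + S (g ∘ suc ∘ suc) (R ∖ b)))
  + ((S (g ∘ suc) (R ∖ a) + S (g ∘ suc ∘ suc) (R ∖ a ∖ b)) + S (g ∘ suc ∘ suc) (R ∖ a))
matchingSum-path₄ g a {x} {y} {z} b R
  ((a≢x ∷ a≢y ∷ a≢z ∷ a≢b ∷ []) ∷ uniq@((x≢y ∷ x≢z ∷ x≢b ∷ []) ∷ uniq′)) fresh@(x∉R ∷ y∉R ∷ z∉R ∷ []) =
  trans (matchingSum-∷ disjoint g (a , x) ((x , y) ∷ (y , z) ∷ (z , b) ∷ R))
        (cong₂ _+_ (matchingSum-path₃ g b R uniq fresh)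
                   (trans (cong (S (g ∘ suc)) tail)
                          (matchingSum-path₂ (g ∘ suc) b (R ∖ a) uniq′ (filter⁺ _ y∉R ∷ filter⁺ _ z∉R ∷ []))))
  where
    tail : filterᵇ (disjoint (a , x)) ((x , y) ∷ (y , z) ∷ (z , b) ∷ R) ≡ (y , z) ∷ (z , b) ∷ R ∖ a
    tail rewrite filterᵇ-∷ (disjoint (a , x)) (x , y) ((y , z) ∷ (z , b) ∷ R)
               | filterᵇ-∷ (disjoint (a , x)) (y , z) ((z , b) ∷ R) | filterᵇ-∷ (disjoint (a , x)) (z , b) R
               | avoids-≢ a≢x a≢y | avoids-endˡ x y | avoids-≢ a≢y a≢z | avoids-≢ x≢y x≢z
               | avoids-≢ a≢z a≢b | avoids-≢ x≢z x≢b =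
      cong (λ R′ → (y , z) ∷ (z , b) ∷ R′) (filterᵇ-disjoint-freshʳ a x x∉R)

filterᵇ-disjoint : ∀ a b R → filterᵇ (disjoint (a , b)) R ≡ R ∖ a ∖ b
filterᵇ-disjoint a b R = sym (filterᵇ-filterᵇ (avoids a) (avoids b) R)

module _ (a x y z b : ℕ) (R : List Edge)
         (uniq : Unique (a ∷ x ∷ y ∷ z ∷ b ∷ [])) (fresh : All (λ v → Fresh v R) (x ∷ y ∷ z ∷ [])) where

  μ₁-subdivide : μ₁ ((a , x) ∷ (x , y) ∷ (y , z) ∷ (z , b) ∷ R) ≡ - μ₁ ((a , b) ∷ R)
  μ₁-subdivide
    rewrite matchingSum-path₄ sign a b R uniq fresh | μ₁-∷ (a , b) R | filterᵇ-disjoint a b R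
          | sign-suc R | sign-suc (R ∖ b) | sign-suc (R ∖ a) | sign-suc-suc (R ∖ b) | sign-suc-suc (R ∖ a)
          | sign-suc-suc (R ∖ a ∖ b) =
    identity (μ₁ R) (μ₁ (R ∖ b)) (μ₁ (R ∖ a)) (μ₁ (R ∖ a ∖ b))
    where identity : ∀ r rb ra rab → r + - rb + - r + (- r + rb) + (- ra + rab + ra) ≡ - (r - rab)
          identity = solve-∀

  ν₁-subdivide : ν₁ ((a , x) ∷ (x , y) ∷ (y , z) ∷ (z , b) ∷ R) ≡
                 - ν₁ ((a , b) ∷ R) - + 2 * μ₁ ((a , b) ∷ R) + μ₁ (R ∖ a) + μ₁ (R ∖ b) - μ₁ (R ∖ a ∖ b)
  ν₁-subdivide
    rewrite matchingSum-path₄ signedSize a b R uniq fresh | ν₁-∷ (a , b) R | μ₁-∷ (a , b) R | filterᵇ-disjoint a b R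
          | signedSize-suc R | signedSize-suc (R ∖ b) | signedSize-suc (R ∖ a)
          | signedSize-suc-suc (R ∖ b) | signedSize-suc-suc (R ∖ a) | signedSize-suc-suc (R ∖ a ∖ b) =
    identity (ν₁ R) (ν₁ (R ∖ b)) (ν₁ (R ∖ a)) (ν₁ (R ∖ a ∖ b)) (μ₁ R) (μ₁ (R ∖ b)) (μ₁ (R ∖ a)) (μ₁ (R ∖ a ∖ b))
    where identity : ∀ r rb ra rab wr wrb wra wrab →
            r + (- rb - wrb) + (- r - wr) + ((- r - wr) + (rb + + 2 * wrb))
              + ((- ra - wra) + (rab + + 2 * wrab) + (ra + + 2 * wra))
            ≡ - (r - rab - wrab) - + 2 * (wr - wrab) + wra + wrb - wrab
          identity = solve-∀

path : ℕ → ℕ → List Edge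
path s zero = []
path s (suc L) = (s , suc s) ∷ path (suc s) L

pendants : ℕ → List Edge
pendants P = (1 , 2 ℕ.+ P) ∷ (1 , 3 ℕ.+ P) ∷ (2 , 4 ℕ.+ P) ∷ (2 , 5 ℕ.+ P) ∷ (P , 6 ℕ.+ P) ∷ (P , 7 ℕ.+ P) ∷ []

-- F⋆ P is F*_{P+8}, indexed so that v_{n-8} is the vertex P.
F⋆ : ℕ → List Edge
F⋆ P = FstarEdgesℕ (8 ℕ.+ P)

applyUpTo-path : ∀ (f : ℕ → Edge) s L → (∀ i → f i ≡ (s ℕ.+ i , suc (s ℕ.+ i))) → applyUpTo f L ≡ path s L
applyUpTo-path f s zero f≗ = refl
applyUpTo-path f s (suc L) f≗ =
  cong₂ _∷_ (trans (f≗ 0) (cong (λ t → t , suc t) (ℕ.+-identityʳ s)))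
            (applyUpTo-path (f ∘ suc) (suc s) L (λ i → trans (f≗ (suc i)) (cong (λ t → t , suc t) (ℕ.+-suc s i))))

F⋆-path-pendants : ∀ P → F⋆ P ≡ path 0 (suc P) ++ pendants P
F⋆-path-pendants P =
  cong (_++ pendants P) (trans (map-applyUpTo (λ i → i) (λ i → i , suc i) (suc P))
                               (applyUpTo-path _ 0 (suc P) (λ i → refl)))

path-++ : ∀ s a b → path s (a ℕ.+ b) ≡ path s a ++ path (s ℕ.+ a) b
path-++ s zero b = cong (λ t → path t b) (sym (ℕ.+-identityʳ s))
path-++ s (suc a) b =
  cong ((s , suc s) ∷_) (trans (path-++ (suc s) a b) (cong (λ t → path (suc s) a ++ path t b) (sym (ℕ.+-suc s a))))

-- Relabelling of F*_n into F*_{n+3}: the vertices after v_k move up by three,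
-- which frees k+1, k+2, k+3 for the vertices subdividing the edge v_k v_{k+1}.
shift₃ : ℕ → ℕ → ℕ
shift₃ k i with i ℕ.≤? k
... | yes _ = i
... | no _ = 3 ℕ.+ i

shift₃ᵉ : ℕ → Edge → Edge
shift₃ᵉ k (a , b) = shift₃ k a , shift₃ k b

shift₃-≤ : ∀ {k i} → i ≤ k → shift₃ k i ≡ i
shift₃-≤ {k} {i} i≤k with i ℕ.≤? k
... | yes _ = refl
... | no i≰k = contradiction i≤k i≰k

shift₃-> : ∀ {k i} → k < i → shift₃ k i ≡ 3 ℕ.+ i
shift₃-> {k} {i} k<i with i ℕ.≤? k
... | yes i≤k = contradiction i≤k (ℕ.<⇒≱ k<i)
... | no _ = refl

shift₃-injective : ∀ k {u v} → shift₃ k u ≡ shift₃ k v → u ≡ v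
shift₃-injective k {u} {v} eq with u ℕ.≤? k | v ℕ.≤? k
... | yes _ | yes _ = eq
... | no _ | no _ = ℕ.+-cancelˡ-≡ 3 u v eq
... | yes u≤k | no v≰k = contradiction (ℕ.≤-trans (ℕ.m≤n+m v 3) (subst (_≤ k) eq u≤k)) v≰k
... | no u≰k | yes v≤k = contradiction (ℕ.≤-trans (ℕ.m≤n+m u 3) (subst (_≤ k) (sym eq) v≤k)) u≰k

shift₃-≡ᵇ : ∀ k u v → (shift₃ k u ℕ.≡ᵇ shift₃ k v) ≡ (u ℕ.≡ᵇ v)
shift₃-≡ᵇ k u v = does-⇔ (mk⇔ (shift₃-injective k) (cong (shift₃ k))) (shift₃ k u ℕ.≟ shift₃ k v) (u ℕ.≟ v)

avoids-shift₃ : ∀ k u e → avoids (shift₃ k u) (shift₃ᵉ k e) ≡ avoids u e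
avoids-shift₃ k u (a , b) rewrite shift₃-≡ᵇ k u a | shift₃-≡ᵇ k u b = refl

matchingSum-shift₃ : ∀ k g xs → matchingSum disjoint g (map (shift₃ᵉ k) xs) ≡ matchingSum disjoint g xs
matchingSum-shift₃ k g xs =
  matchingSum-map disjoint disjoint (shift₃ᵉ k) (λ {(a , b)} {e} _ _ → cong₂ _∧_ (avoids-shift₃ k a e) (avoids-shift₃ k b e))
                  g (All.universal (λ _ → tt) xs)

map-shift₃-path-≤ : ∀ k s L → s ℕ.+ L ≤ k → map (shift₃ᵉ k) (path s L) ≡ path s L
map-shift₃-path-≤ k s zero _ = refl
map-shift₃-path-≤ k s (suc L) s+1+L≤k =
  cong₂ _∷_ (cong₂ _,_ (shift₃-≤ (ℕ.≤-trans (ℕ.m≤m+n s (suc L)) s+1+L≤k))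
                       (shift₃-≤ (ℕ.≤-trans (s≤s (ℕ.m≤m+n s L)) (subst (_≤ k) (ℕ.+-suc s L) s+1+L≤k))))
            (map-shift₃-path-≤ k (suc s) L (subst (_≤ k) (ℕ.+-suc s L) s+1+L≤k))

map-shift₃-path-> : ∀ k s L → k < s → map (shift₃ᵉ k) (path s L) ≡ path (3 ℕ.+ s) L
map-shift₃-path-> k s zero _ = refl
map-shift₃-path-> k s (suc L) k<s =
  cong₂ _∷_ (cong₂ _,_ (shift₃-> k<s) (shift₃-> (ℕ.m<n⇒m<1+n k<s))) (map-shift₃-path-> k (suc s) L (ℕ.m<n⇒m<1+n k<s))

map-shift₃-pendants : ∀ k P → 2 ≤ k → k < P → map (shift₃ᵉ k) (pendants P) ≡ pendants (3 ℕ.+ P)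
map-shift₃-pendants k P 2≤k k<P = shifted (λ j → ℕ.<-≤-trans k<P (ℕ.m≤n+m P j))
  where
    shifted : (∀ j → k < j ℕ.+ P) → map (shift₃ᵉ k) (pendants P) ≡ pendants (3 ℕ.+ P)
    shifted k<j+P
      rewrite shift₃-≤ (ℕ.≤-trans (s≤s z≤n) 2≤k) | shift₃-≤ 2≤k | shift₃-> k<P
            | shift₃-> (k<j+P 2) | shift₃-> (k<j+P 3) | shift₃-> (k<j+P 4)
            | shift₃-> (k<j+P 5) | shift₃-> (k<j+P 6) | shift₃-> (k<j+P 7) = refl

shift₃-skips : ∀ k a j → 1 ≤ j → j ≤ 3 → j ℕ.+ k ≢ shift₃ k a
shift₃-skips k a j 1≤j j≤3 eq with a ℕ.≤? k
... | yes a≤k = ℕ.<⇒≱ (ℕ.<-≤-trans (ℕ.n<1+n k) (ℕ.+-monoˡ-≤ k 1≤j)) (subst (_≤ k) (sym eq) a≤k)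
... | no a≰k =
  ℕ.<⇒≢ (ℕ.≤-<-trans (ℕ.+-monoˡ-≤ k j≤3) (ℕ.+-monoʳ-< 3 (ℕ.≰⇒> a≰k))) eq

fresh-shift₃ : ∀ k j → 1 ≤ j → j ≤ 3 → ∀ X → Fresh (j ℕ.+ k) (map (shift₃ᵉ k) X)
fresh-shift₃ k j 1≤j j≤3 [] = []
fresh-shift₃ k j 1≤j j≤3 ((a , b) ∷ X) =
  Equivalence.from T-≡ (avoids-≢ (shift₃-skips k a j 1≤j j≤3) (shift₃-skips k b j 1≤j j≤3)) ∷ fresh-shift₃ k j 1≤j j≤3 X

-- F*_{P+8} without its path edge v_k v_{k+1}, for P = 1 + k + L.
F⋆-rest : ℕ → ℕ → List Edge
F⋆-rest k L = path 0 k ++ path (suc k) (suc L) ++ pendants (suc k ℕ.+ L)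

F⋆↭edge∷rest : ∀ k L → F⋆ (suc k ℕ.+ L) ↭ (k , suc k) ∷ F⋆-rest k L
F⋆↭edge∷rest k L = subst (_↭ (k , suc k) ∷ F⋆-rest k L) (sym split) (shift (k , suc k) (path 0 k) _)
  where
    P = suc k ℕ.+ L
    split : F⋆ P ≡ path 0 k ++ (k , suc k) ∷ path (suc k) (suc L) ++ pendants P
    split = begin
      F⋆ P                                                          ≡⟨ F⋆-path-pendants P ⟩
      path 0 (suc P) ++ pendants P                                  ≡⟨ cong (λ n → path 0 n ++ pendants P) (sym (trans (ℕ.+-suc k (suc L)) (cong suc (ℕ.+-suc k L)))) ⟩
      path 0 (k ℕ.+ suc (suc L)) ++ pendants P                      ≡⟨ cong (_++ pendants P) (path-++ 0 k (suc (suc L))) ⟩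
      (path 0 k ++ (k , suc k) ∷ path (suc k) (suc L)) ++ pendants P ≡⟨ ++-assoc (path 0 k) _ (pendants P) ⟩
      path 0 k ++ (k , suc k) ∷ path (suc k) (suc L) ++ pendants P  ∎
      where open ≡-Reasoning

map-shift₃-rest : ∀ k L → 2 ≤ k →
  map (shift₃ᵉ k) (F⋆-rest k L) ≡ path 0 k ++ path (4 ℕ.+ k) (suc L) ++ pendants (3 ℕ.+ (suc k ℕ.+ L))
map-shift₃-rest k L 2≤k =
  trans (map-++ (shift₃ᵉ k) (path 0 k) _)
        (cong₂ _++_ (map-shift₃-path-≤ k 0 k ℕ.≤-refl)
                    (trans (map-++ (shift₃ᵉ k) (path (suc k) (suc L)) _)
                           (cong₂ _++_ (map-shift₃-path-> k (suc k) (suc L) (ℕ.n<1+n k))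
                                       (map-shift₃-pendants k (suc k ℕ.+ L) 2≤k (s≤s (ℕ.m≤m+n k L))))))

F⋆↭subdivided : ∀ k L → 2 ≤ k → F⋆ (3 ℕ.+ (suc k ℕ.+ L)) ↭ path k 4 ++ map (shift₃ᵉ k) (F⋆-rest k L)
F⋆↭subdivided k L 2≤k =
  subst₂ _↭_ (sym split) (cong (path k 4 ++_) (sym (map-shift₃-rest k L 2≤k))) (shifts (path 0 k) (path k 4))
  where
    P′ = 3 ℕ.+ (suc k ℕ.+ L)
    length-identity : ∀ k L → suc (3 ℕ.+ (suc k ℕ.+ L)) ≡ k ℕ.+ (4 ℕ.+ suc L)
    length-identity = ℕ-Solver.solve-∀
    split : F⋆ P′ ≡ path 0 k ++ path k 4 ++ path (4 ℕ.+ k) (suc L) ++ pendants P′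
    split = begin
      F⋆ P′                                                        ≡⟨ F⋆-path-pendants P′ ⟩
      path 0 (suc P′) ++ pendants P′                               ≡⟨ cong (λ n → path 0 n ++ pendants P′) (length-identity k L) ⟩
      path 0 (k ℕ.+ (4 ℕ.+ suc L)) ++ pendants P′                  ≡⟨ cong (_++ pendants P′) (path-++ 0 k (4 ℕ.+ suc L)) ⟩
      (path 0 k ++ path k (4 ℕ.+ suc L)) ++ pendants P′            ≡⟨ cong (λ p → (path 0 k ++ p) ++ pendants P′) (path-++ k 4 (suc L)) ⟩
      (path 0 k ++ path k 4 ++ path (k ℕ.+ 4) (suc L)) ++ pendants P′ ≡⟨ cong (λ s → (path 0 k ++ path k 4 ++ path s (suc L)) ++ pendants P′) (ℕ.+-comm k 4) ⟩
      (path 0 k ++ path k 4 ++ path (4 ℕ.+ k) (suc L)) ++ pendants P′ ≡⟨ ++-assoc (path 0 k) (path k 4 ++ path (4 ℕ.+ k) (suc L)) (pendants P′) ⟩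
      path 0 k ++ (path k 4 ++ path (4 ℕ.+ k) (suc L)) ++ pendants P′ ≡⟨ cong (path 0 k ++_) (++-assoc (path k 4) (path (4 ℕ.+ k) (suc L)) (pendants P′)) ⟩
      path 0 k ++ path k 4 ++ path (4 ℕ.+ k) (suc L) ++ pendants P′  ∎
      where open ≡-Reasoning

gadget-unique : ∀ k → Unique (k ∷ suc k ∷ suc (suc k) ∷ suc (suc (suc k)) ∷ suc (suc (suc (suc k))) ∷ [])
gadget-unique k =
  (ℕ.m≢1+n+m k {0} ∷ ℕ.m≢1+n+m k {1} ∷ ℕ.m≢1+n+m k {2} ∷ ℕ.m≢1+n+m k {3} ∷ [])
  ∷ (ℕ.m≢1+n+m (suc k) {0} ∷ ℕ.m≢1+n+m (suc k) {1} ∷ ℕ.m≢1+n+m (suc k) {2} ∷ [])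
  ∷ (ℕ.m≢1+n+m (suc (suc k)) {0} ∷ ℕ.m≢1+n+m (suc (suc k)) {1} ∷ [])
  ∷ (ℕ.m≢1+n+m (suc (suc (suc k))) {0} ∷ []) ∷ [] ∷ []

gadget-fresh : ∀ k X → All (λ v → Fresh v (map (shift₃ᵉ k) X)) (suc k ∷ suc (suc k) ∷ suc (suc (suc k)) ∷ [])
gadget-fresh k X =
  fresh-shift₃ k 1 (s≤s z≤n) (s≤s z≤n) X ∷ fresh-shift₃ k 2 (s≤s z≤n) (s≤s (s≤s z≤n)) X
  ∷ fresh-shift₃ k 3 (s≤s z≤n) ℕ.≤-refl X ∷ []

module F⋆-subdivision (k L : ℕ) (2≤k : 2 ≤ k) where

  private
    P = suc k ℕ.+ L
    R = F⋆-rest k L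
    R′ = map (shift₃ᵉ k)

    shift₃-edge : shift₃ᵉ k (k , suc k) ≡ (k , suc (suc (suc (suc k))))
    shift₃-edge = cong₂ _,_ (shift₃-≤ ℕ.≤-refl) (shift₃-> (ℕ.n<1+n k))

    μ₁-F⋆ : ∀ p → μ₁ (filterᵇ p (F⋆ P)) ≡ μ₁ (filterᵇ p ((k , suc k) ∷ R))
    μ₁-F⋆ p = matchingSum-filterᵇ-↭ disjoint disjoint-sym (F⋆↭edge∷rest k L) p sign

  -- p selects edges of F*_{n+3} and p′ the corresponding edges of F*_n.
  μ₁-filter-subdivided : ∀ (p p′ : Edge → Bool) → (∀ e → p (shift₃ᵉ k e) ≡ p′ e) →
    All (T ∘ p) (path k 4) → T (p′ (k , suc k)) →
    μ₁ (filterᵇ p (F⋆ (3 ℕ.+ P))) ≡ - μ₁ (filterᵇ p′ (F⋆ P))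
  μ₁-filter-subdivided p p′ p∘shift≗p′ p-gadget p′-edge = begin
    μ₁ (filterᵇ p (F⋆ (3 ℕ.+ P)))
      ≡⟨ matchingSum-filterᵇ-↭ disjoint disjoint-sym (F⋆↭subdivided k L 2≤k) p sign ⟩
    μ₁ (filterᵇ p (path k 4 ++ R′ R))
      ≡⟨ cong μ₁ (trans (filter-++ (T? ∘ p) (path k 4) (R′ R)) (cong (_++ filterᵇ p (R′ R)) (filter-all (T? ∘ p) p-gadget))) ⟩
    μ₁ (path k 4 ++ filterᵇ p (R′ R))
      ≡⟨ cong (λ X → μ₁ (path k 4 ++ X)) (trans (filterᵇ-map p (shift₃ᵉ k) R) (cong R′ (filterᵇ-cong p∘shift≗p′ R))) ⟩
    μ₁ (path k 4 ++ R′ (filterᵇ p′ R))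
      ≡⟨ μ₁-subdivide _ _ _ _ _ (R′ (filterᵇ p′ R)) (gadget-unique k) (gadget-fresh k (filterᵇ p′ R)) ⟩
    - μ₁ ((k , suc (suc (suc (suc k)))) ∷ R′ (filterᵇ p′ R))
      ≡⟨ cong (λ e → - μ₁ (e ∷ R′ (filterᵇ p′ R))) (sym shift₃-edge) ⟩
    - μ₁ (R′ ((k , suc k) ∷ filterᵇ p′ R))
      ≡⟨ cong -_ (matchingSum-shift₃ k sign ((k , suc k) ∷ filterᵇ p′ R)) ⟩
    - μ₁ ((k , suc k) ∷ filterᵇ p′ R)
      ≡⟨ cong (λ X → - μ₁ X) (sym (filter-accept (T? ∘ p′) p′-edge)) ⟩
    - μ₁ (filterᵇ p′ ((k , suc k) ∷ R))
      ≡⟨ cong -_ (sym (μ₁-F⋆ p′)) ⟩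
    - μ₁ (filterᵇ p′ (F⋆ P)) ∎
    where open ≡-Reasoning

  private
    subdivided-edge : ∀ g → matchingSum disjoint g ((k , suc (suc (suc (suc k)))) ∷ R′ R) ≡ matchingSum disjoint g (F⋆ P)
    subdivided-edge g = begin
      matchingSum disjoint g ((k , suc (suc (suc (suc k)))) ∷ R′ R) ≡⟨ cong (λ e → matchingSum disjoint g (e ∷ R′ R)) (sym shift₃-edge) ⟩
      matchingSum disjoint g (R′ ((k , suc k) ∷ R))                ≡⟨ matchingSum-shift₃ k g ((k , suc k) ∷ R) ⟩
      matchingSum disjoint g ((k , suc k) ∷ R)                     ≡⟨ sym (matchingSum-↭ disjoint disjoint-sym (F⋆↭edge∷rest k L) g) ⟩
      matchingSum disjoint g (F⋆ P)                                ∎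
      where open ≡-Reasoning

    μ₁-filter-away-from-edge : ∀ (q q′ : Edge → Bool) → (∀ e → q (shift₃ᵉ k e) ≡ q′ e) → ¬ T (q′ (k , suc k)) →
                               μ₁ (filterᵇ q (R′ R)) ≡ μ₁ (filterᵇ q′ (F⋆ P))
    μ₁-filter-away-from-edge q q′ q∘shift≗q′ ¬q′-edge = begin
      μ₁ (filterᵇ q (R′ R))               ≡⟨ cong μ₁ (trans (filterᵇ-map q (shift₃ᵉ k) R) (cong R′ (filterᵇ-cong q∘shift≗q′ R))) ⟩
      μ₁ (R′ (filterᵇ q′ R))              ≡⟨ matchingSum-shift₃ k sign (filterᵇ q′ R) ⟩
      μ₁ (filterᵇ q′ R)                   ≡⟨ cong μ₁ (sym (filter-reject (T? ∘ q′) ¬q′-edge)) ⟩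
      μ₁ (filterᵇ q′ ((k , suc k) ∷ R))   ≡⟨ sym (μ₁-F⋆ q′) ⟩
      μ₁ (filterᵇ q′ (F⋆ P))              ∎
      where open ≡-Reasoning

    avoids-shift₃-k : ∀ e → avoids k (shift₃ᵉ k e) ≡ avoids k e
    avoids-shift₃-k e = trans (cong (λ v → avoids v (shift₃ᵉ k e)) (sym (shift₃-≤ {k} ℕ.≤-refl))) (avoids-shift₃ k k e)

    avoids-shift₃-suc : ∀ e → avoids (suc (suc (suc (suc k)))) (shift₃ᵉ k e) ≡ avoids (suc k) e
    avoids-shift₃-suc e = trans (cong (λ v → avoids v (shift₃ᵉ k e)) (sym (shift₃-> (ℕ.n<1+n k)))) (avoids-shift₃ k (suc k) e)

    edge-not-avoids-k : ¬ T (avoids k (k , suc k))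
    edge-not-avoids-k = subst (λ b → ¬ T b) (sym (avoids-endˡ k (suc k))) (λ ())

    edge-not-avoids-suc-k : ¬ T (avoids (suc k) (k , suc k))
    edge-not-avoids-suc-k = subst (λ b → ¬ T b) (sym (avoids-endʳ k (suc k))) (λ ())

  ν₁-subdivided : ν₁ (F⋆ (3 ℕ.+ P)) ≡
    - ν₁ (F⋆ P) - + 2 * μ₁ (F⋆ P) + μ₁ (F⋆ P ∖ k) + μ₁ (F⋆ P ∖ suc k) - μ₁ (F⋆ P ∖ k ∖ suc k)
  ν₁-subdivided = begin
    ν₁ (F⋆ (3 ℕ.+ P))
      ≡⟨ matchingSum-↭ disjoint disjoint-sym (F⋆↭subdivided k L 2≤k) signedSize ⟩
    ν₁ (path k 4 ++ R′ R)
      ≡⟨ ν₁-subdivide _ _ _ _ _ (R′ R) (gadget-unique k) (gadget-fresh k R) ⟩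
    - ν₁ (e′ ∷ R′ R) - + 2 * μ₁ (e′ ∷ R′ R) + μ₁ (R′ R ∖ k) + μ₁ (R′ R ∖ k′) - μ₁ (R′ R ∖ k ∖ k′)
      ≡⟨ cong₂ _-_ (cong₂ _+_ (cong₂ _+_ (cong₂ _-_ (cong -_ (subdivided-edge signedSize))
                                                    (cong (+ 2 *_) (subdivided-edge sign)))
                                        (μ₁-filter-away-from-edge _ _ avoids-shift₃-k edge-not-avoids-k))
                              (μ₁-filter-away-from-edge _ _ avoids-shift₃-suc edge-not-avoids-suc-k))
                   both ⟩
    - ν₁ (F⋆ P) - + 2 * μ₁ (F⋆ P) + μ₁ (F⋆ P ∖ k) + μ₁ (F⋆ P ∖ suc k) - μ₁ (F⋆ P ∖ k ∖ suc k) ∎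
    where
      open ≡-Reasoning
      k′ = suc (suc (suc (suc k)))
      e′ = (k , k′)
      both : μ₁ (R′ R ∖ k ∖ k′) ≡ μ₁ (F⋆ P ∖ k ∖ suc k)
      both = begin
        μ₁ (R′ R ∖ k ∖ k′)
          ≡⟨ cong μ₁ (filterᵇ-filterᵇ (avoids k) (avoids k′) (R′ R)) ⟩
        μ₁ (filterᵇ (λ e → avoids k e ∧ avoids k′ e) (R′ R))
          ≡⟨ μ₁-filter-away-from-edge _ _ (λ e → cong₂ _∧_ (avoids-shift₃-k e) (avoids-shift₃-suc e))
                                      (edge-not-avoids-k ∘ proj₁ ∘ Equivalence.to T-∧) ⟩
        μ₁ (filterᵇ (λ e → avoids k e ∧ avoids (suc k) e) (F⋆ P))
          ≡⟨ cong μ₁ (sym (filterᵇ-filterᵇ (avoids k) (avoids (suc k)) (F⋆ P))) ⟩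
        μ₁ (F⋆ P ∖ k ∖ suc k) ∎

μ₁-F⋆-step : ∀ {k P} → 2 ≤ k → k < P → ∀ (p p′ : Edge → Bool) → (∀ e → p (shift₃ᵉ k e) ≡ p′ e) →
             All (T ∘ p) (path k 4) → T (p′ (k , suc k)) →
             μ₁ (filterᵇ p (F⋆ (3 ℕ.+ P))) ≡ - μ₁ (filterᵇ p′ (F⋆ P))
μ₁-F⋆-step {k} 2≤k k<P with L , refl ← ℕ.m≤n⇒∃[o]m+o≡n k<P = F⋆-subdivision.μ₁-filter-subdivided k L 2≤k

ν₁-F⋆-step : ∀ {P} → 2 < P →
  ν₁ (F⋆ (3 ℕ.+ P)) ≡ - ν₁ (F⋆ P) - + 2 * μ₁ (F⋆ P) + μ₁ (F⋆ P ∖ 2) + μ₁ (F⋆ P ∖ 3) - μ₁ (F⋆ P ∖ 2 ∖ 3)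
ν₁-F⋆-step 2<P with L , refl ← ℕ.m≤n⇒∃[o]m+o≡n 2<P = F⋆-subdivision.ν₁-subdivided 2 L ℕ.≤-refl

T-avoids : ∀ {u a b} → u ≢ a → u ≢ b → T (avoids u (a , b))
T-avoids u≢a u≢b = Equivalence.from T-≡ (avoids-≢ u≢a u≢b)

path-avoids : ∀ u s L → u < s ⊎ s ℕ.+ L < u → All (T ∘ avoids u) (path s L)
path-avoids u s zero _ = []
path-avoids u s (suc L) (inj₁ u<s) =
  T-avoids (ℕ.<⇒≢ u<s) (ℕ.<⇒≢ (ℕ.m<n⇒m<1+n u<s)) ∷ path-avoids u (suc s) L (inj₁ (ℕ.m<n⇒m<1+n u<s))
path-avoids u s (suc L) (inj₂ s+1+L<u) =
  T-avoids (ℕ.>⇒≢ (ℕ.≤-<-trans (ℕ.m≤m+n s (suc L)) s+1+L<u))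
           (ℕ.>⇒≢ (ℕ.≤-<-trans (s≤s (ℕ.m≤m+n s L)) s+1+L<′u))
  ∷ path-avoids u (suc s) L (inj₂ s+1+L<′u)
  where s+1+L<′u = subst (_< u) (ℕ.+-suc s L) s+1+L<u

-- The last field is what lets the ν₁-recurrence of the step at v₂ keep its sign.
record Invariant (P : ℕ) : Set where
  field
    ε : ℤ
    μ₁-vanishes : μ₁ (F⋆ P) ≡ + 0
    ν₁-negative : ε * ν₁ (F⋆ P) ℤ.< + 0
    μ₁-∖-positive : ∀ u → u < 8 ℕ.+ P → + 0 ℤ.< ε * μ₁ (F⋆ P ∖ u)
    μ₁-∖₂₃-negative : ε * μ₁ (F⋆ P ∖ 2 ∖ 3) ℤ.< + 0

avoids-shift₃-of : ∀ k u′ {u} → shift₃ k u′ ≡ u → ∀ e → avoids u (shift₃ᵉ k e) ≡ avoids u′ e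
avoids-shift₃-of k u′ refl e = avoids-shift₃ k u′ e

edge-avoids : ∀ {u k} → u < k → T (avoids u (k , suc k))
edge-avoids u<k = T-avoids (ℕ.<⇒≢ u<k) (ℕ.<⇒≢ (ℕ.m<n⇒m<1+n u<k))

-- Deleting u from F*_{n+3}: subdivide at v₂ when u lies outside the gadget 2, …, 6, and
-- otherwise at v_{P-1}, far from u.
module _ {P : ℕ} (9≤P : 9 ≤ P) where

  private
    2<P : 2 < P
    2<P = ℕ.<-≤-trans (from-yes (2 ℕ.<? 9)) 9≤P
    k₀ = P ℕ.∸ 1
    k₀<P : k₀ < P
    k₀<P = ℕ.∸-monoʳ-< (s≤s z≤n) (ℕ.<-≤-trans (s≤s z≤n) 9≤P)
    below-k₀ : ∀ {u} → u < 7 → u < k₀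
    below-k₀ u<7 = ℕ.<-≤-trans u<7 (ℕ.≤-trans (ℕ.n≤1+n 7) (ℕ.∸-monoˡ-≤ 1 9≤P))
    2≤k₀ : 2 ≤ k₀
    2≤k₀ = ℕ.<⇒≤ (below-k₀ (from-yes (2 ℕ.<? 7)))

  μ₁-F⋆-subdivided : μ₁ (F⋆ (3 ℕ.+ P)) ≡ - μ₁ (F⋆ P)
  μ₁-F⋆-subdivided = begin
    μ₁ (F⋆ (3 ℕ.+ P))                           ≡⟨ cong μ₁ (sym (filterᵇ-const-true (F⋆ (3 ℕ.+ P)))) ⟩
    μ₁ (filterᵇ (λ _ → true) (F⋆ (3 ℕ.+ P)))    ≡⟨ μ₁-F⋆-step {2} ℕ.≤-refl 2<P (λ _ → true) (λ _ → true) (λ _ → refl) (_ ∷ _ ∷ _ ∷ _ ∷ []) _ ⟩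
    - μ₁ (filterᵇ (λ _ → true) (F⋆ P))          ≡⟨ cong (λ X → - μ₁ X) (filterᵇ-const-true (F⋆ P)) ⟩
    - μ₁ (F⋆ P)                                 ∎
    where open ≡-Reasoning

  μ₁-F⋆∖₂₃-subdivided : μ₁ (F⋆ (3 ℕ.+ P) ∖ 2 ∖ 3) ≡ - μ₁ (F⋆ P ∖ 2 ∖ 3)
  μ₁-F⋆∖₂₃-subdivided = begin
    μ₁ (F⋆ (3 ℕ.+ P) ∖ 2 ∖ 3)
      ≡⟨ cong μ₁ (filterᵇ-filterᵇ (avoids 2) (avoids 3) (F⋆ (3 ℕ.+ P))) ⟩
    μ₁ (filterᵇ (λ e → avoids 2 e ∧ avoids 3 e) (F⋆ (3 ℕ.+ P)))
      ≡⟨ μ₁-F⋆-step 2≤k₀ k₀<P _ _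
           (λ e → cong₂ _∧_ (avoids-shift₃-of k₀ 2 (shift₃-≤ (ℕ.<⇒≤ 2<k₀)) e) (avoids-shift₃-of k₀ 3 (shift₃-≤ (ℕ.<⇒≤ 3<k₀)) e))
           (All.zipWith (Equivalence.from T-∧) (path-avoids 2 k₀ 4 (inj₁ 2<k₀) , path-avoids 3 k₀ 4 (inj₁ 3<k₀)))
           (Equivalence.from T-∧ (edge-avoids 2<k₀ , edge-avoids 3<k₀)) ⟩
    - μ₁ (filterᵇ (λ e → avoids 2 e ∧ avoids 3 e) (F⋆ P))
      ≡⟨ cong (λ X → - μ₁ X) (sym (filterᵇ-filterᵇ (avoids 2) (avoids 3) (F⋆ P))) ⟩
    - μ₁ (F⋆ P ∖ 2 ∖ 3) ∎
    where
      open ≡-Reasoning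
      2<k₀ = below-k₀ (from-yes (2 ℕ.<? 7))
      3<k₀ = below-k₀ (from-yes (3 ℕ.<? 7))

  μ₁-F⋆∖-subdivided : ∀ u → u < 8 ℕ.+ (3 ℕ.+ P) →
                      Σ ℕ λ u′ → u′ < 8 ℕ.+ P × μ₁ (F⋆ (3 ℕ.+ P) ∖ u) ≡ - μ₁ (F⋆ P ∖ u′)
  μ₁-F⋆∖-subdivided u u<11+P with u ℕ.<? 2 | u ℕ.<? 7
  ... | yes u<2 | _ =
    u , ℕ.<-≤-trans u<2 (s≤s (s≤s z≤n)) ,
    μ₁-F⋆-step ℕ.≤-refl 2<P _ _ (avoids-shift₃-of 2 u (shift₃-≤ (ℕ.<⇒≤ u<2))) (path-avoids u 2 4 (inj₁ u<2)) (edge-avoids u<2)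
  ... | no _ | yes u<7 =
    u , ℕ.<-≤-trans u<7 (ℕ.m≤m+n 7 (suc P)) ,
    μ₁-F⋆-step 2≤k₀ k₀<P _ _ (avoids-shift₃-of k₀ u (shift₃-≤ (ℕ.<⇒≤ (below-k₀ u<7))))
               (path-avoids u k₀ 4 (inj₁ (below-k₀ u<7))) (edge-avoids (below-k₀ u<7))
  ... | no _ | no u≮7 =
    u ℕ.∸ 3 , ℕ.+-cancelˡ-< 3 _ _ (subst (_< 11 ℕ.+ P) u≡3+u′ u<11+P) ,
    μ₁-F⋆-step ℕ.≤-refl 2<P _ _ (avoids-shift₃-of 2 (u ℕ.∸ 3) (trans (shift₃-> 2<u′) (sym u≡3+u′)))
               (path-avoids u 2 4 (inj₂ 6<u)) (T-avoids (ℕ.>⇒≢ 2<u′) (ℕ.>⇒≢ 3<u′))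
    where
      6<u : 6 < u
      6<u = ℕ.≮⇒≥ u≮7
      u≡3+u′ : u ≡ 3 ℕ.+ (u ℕ.∸ 3)
      u≡3+u′ = sym (ℕ.m+[n∸m]≡n (ℕ.≤-trans (from-yes (3 ℕ.≤? 7)) 6<u))
      3<u′ : 3 < u ℕ.∸ 3
      3<u′ = ℕ.∸-monoˡ-≤ 3 6<u
      2<u′ : 2 < u ℕ.∸ 3
      2<u′ = ℕ.<-trans (ℕ.n<1+n 2) 3<u′

invariant-step : ∀ {P} → 9 ≤ P → Invariant P → Invariant (3 ℕ.+ P)
invariant-step {P} 9≤P inv = record
  { ε = - ε
  ; μ₁-vanishes = trans (μ₁-F⋆-subdivided 9≤P) (cong -_ μ₁-vanishes)
  ; ν₁-negative = ν₁-negative′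
  ; μ₁-∖-positive = μ₁-∖-positive′
  ; μ₁-∖₂₃-negative = subst (ℤ._< + 0) (sym (trans (cong (- ε *_) (μ₁-F⋆∖₂₃-subdivided 9≤P)) (flip-sign ε _)))
                            μ₁-∖₂₃-negative
  }
  where
    open Invariant inv
    flip-sign : ∀ ε x → - ε * - x ≡ ε * x
    flip-sign = solve-∀

    μ₁-∖-positive′ : ∀ u → u < 8 ℕ.+ (3 ℕ.+ P) → + 0 ℤ.< - ε * μ₁ (F⋆ (3 ℕ.+ P) ∖ u)
    μ₁-∖-positive′ u u<11+P with μ₁-F⋆∖-subdivided 9≤P u u<11+P
    ... | u′ , u′<8+P , eq = subst (+ 0 ℤ.<_) (sym (trans (cong (- ε *_) eq) (flip-sign ε _))) (μ₁-∖-positive u′ u′<8+P)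

    below-8+P : ∀ {u} → u < 8 → u < 8 ℕ.+ P
    below-8+P u<8 = ℕ.<-≤-trans u<8 (ℕ.m≤m+n 8 P)

    -- the new ν₁ combines four quantities whose signs the invariant fixes
    ν₁-combination : ∀ ε v a b c → - ε * (- v - + 2 * + 0 + a + b - c) ≡ - ((ε * a + ε * b) + (- (ε * v) + - (ε * c)))
    ν₁-combination = solve-∀

    ν₁-negative′ : - ε * ν₁ (F⋆ (3 ℕ.+ P)) ℤ.< + 0
    ν₁-negative′ = subst (ℤ._< + 0) (sym ν₁-expanded) (ℤ.neg-mono-< (ℤ.+-mono-< positives negatives))
      where
        ν₁-expanded : - ε * ν₁ (F⋆ (3 ℕ.+ P)) ≡
          - ((ε * μ₁ (F⋆ P ∖ 2) + ε * μ₁ (F⋆ P ∖ 3)) + (- (ε * ν₁ (F⋆ P)) + - (ε * μ₁ (F⋆ P ∖ 2 ∖ 3))))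
        ν₁-expanded = trans (cong (- ε *_) (trans (ν₁-F⋆-step (ℕ.<-≤-trans (from-yes (2 ℕ.<? 9)) 9≤P))
                                                  (cong (λ w → - ν₁ (F⋆ P) - + 2 * w + μ₁ (F⋆ P ∖ 2) + μ₁ (F⋆ P ∖ 3)
                                                                 - μ₁ (F⋆ P ∖ 2 ∖ 3)) μ₁-vanishes)))
                            (ν₁-combination ε (ν₁ (F⋆ P)) (μ₁ (F⋆ P ∖ 2)) (μ₁ (F⋆ P ∖ 3)) (μ₁ (F⋆ P ∖ 2 ∖ 3)))
        positives = ℤ.+-mono-< (μ₁-∖-positive 2 (below-8+P (from-yes (2 ℕ.<? 8))))
                               (μ₁-∖-positive 3 (below-8+P (from-yes (3 ℕ.<? 8))))
        negatives = ℤ.+-mono-< (ℤ.neg-mono-< ν₁-negative) (ℤ.neg-mono-< μ₁-∖₂₃-negative)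

-- Evaluation of μ₁ and ν₁ by the recurrences μ₁-∷ and ν₁-∷, which costs about as many steps as
-- there are matchings instead of 2^|R| sublists; the fuel is the length of the edge list.
μ₁ᶠ ν₁ᶠ : ℕ → List Edge → ℤ
μ₁ᶠ zero R = + 0
μ₁ᶠ (suc n) [] = + 1
μ₁ᶠ (suc n) (e ∷ R) = μ₁ᶠ n R - μ₁ᶠ n (filterᵇ (disjoint e) R)
ν₁ᶠ zero R = + 0
ν₁ᶠ (suc n) [] = + 0
ν₁ᶠ (suc n) (e ∷ R) = ν₁ᶠ n R - ν₁ᶠ n (filterᵇ (disjoint e) R) - μ₁ᶠ n (filterᵇ (disjoint e) R)

μ₁ᶠ-correct : ∀ n R → length R < n → μ₁ᶠ n R ≡ μ₁ R
μ₁ᶠ-correct (suc n) [] _ = refl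
μ₁ᶠ-correct (suc n) (e ∷ R) (s≤s |R|<n) =
  trans (cong₂ _-_ (μ₁ᶠ-correct n R |R|<n) (μ₁ᶠ-correct n _ (ℕ.≤-<-trans (length-filter _ R) |R|<n)))
        (sym (μ₁-∷ e R))

ν₁ᶠ-correct : ∀ n R → length R < n → ν₁ᶠ n R ≡ ν₁ R
ν₁ᶠ-correct (suc n) [] _ = refl
ν₁ᶠ-correct (suc n) (e ∷ R) (s≤s |R|<n) =
  trans (cong₂ _-_ (cong₂ _-_ (ν₁ᶠ-correct n R |R|<n) (ν₁ᶠ-correct n _ |R′|<n)) (μ₁ᶠ-correct n _ |R′|<n))
        (sym (ν₁-∷ e R))
  where |R′|<n = ℕ.≤-<-trans (length-filter _ R) |R|<n

μ₁ᶜ ν₁ᶜ : List Edge → ℤ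
μ₁ᶜ R = μ₁ᶠ (suc (length R)) R
ν₁ᶜ R = ν₁ᶠ (suc (length R)) R

μ₁ᶜ-correct : ∀ R → μ₁ᶜ R ≡ μ₁ R
μ₁ᶜ-correct R = μ₁ᶠ-correct (suc (length R)) R ℕ.≤-refl

ν₁ᶜ-correct : ∀ R → ν₁ᶜ R ≡ ν₁ R
ν₁ᶜ-correct R = ν₁ᶠ-correct (suc (length R)) R ℕ.≤-refl

ComputedInvariant : ℕ → ℤ → Set
ComputedInvariant P ε =
  μ₁ᶜ (F⋆ P) ≡ + 0 × ε * ν₁ᶜ (F⋆ P) ℤ.< + 0 ×
  (∀ {u} → u < 8 ℕ.+ P → + 0 ℤ.< ε * μ₁ᶜ (F⋆ P ∖ u)) × ε * μ₁ᶜ (F⋆ P ∖ 2 ∖ 3) ℤ.< + 0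

computedInvariant? : ∀ P ε → Dec (ComputedInvariant P ε)
computedInvariant? P ε =
  μ₁ᶜ (F⋆ P) ℤ.≟ + 0 ×-dec ε * ν₁ᶜ (F⋆ P) ℤ.<? + 0 ×-dec
  ℕ.allUpTo? (λ u → + 0 ℤ.<? ε * μ₁ᶜ (F⋆ P ∖ u)) (8 ℕ.+ P) ×-dec ε * μ₁ᶜ (F⋆ P ∖ 2 ∖ 3) ℤ.<? + 0

invariant-by-computation : ∀ {P ε} → ComputedInvariant P ε → Invariant P
invariant-by-computation {P} {ε} (μ₁-zero , ν₁-neg , ∖-pos , ∖₂₃-neg) = record
  { ε = ε
  ; μ₁-vanishes = trans (sym (μ₁ᶜ-correct (F⋆ P))) μ₁-zero
  ; ν₁-negative = subst (λ x → ε * x ℤ.< + 0) (ν₁ᶜ-correct (F⋆ P)) ν₁-neg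
  ; μ₁-∖-positive = λ u u< → subst (λ x → + 0 ℤ.< ε * x) (μ₁ᶜ-correct (F⋆ P ∖ u)) (∖-pos u<)
  ; μ₁-∖₂₃-negative = subst (λ x → ε * x ℤ.< + 0) (μ₁ᶜ-correct (F⋆ P ∖ 2 ∖ 3)) ∖₂₃-neg
  }

invariant₃ : Invariant 3
invariant₃ = invariant-by-computation {ε = + 1} (from-yes (computedInvariant? 3 (+ 1)))

invariant₆ : Invariant 6
invariant₆ = invariant-by-computation {ε = - + 1} (from-yes (computedInvariant? 6 (- + 1)))

invariant₉ : Invariant 9
invariant₉ = invariant-by-computation {ε = + 1} (from-yes (computedInvariant? 9 (+ 1)))

invariant : ∀ t → Invariant (3 ℕ.+ t ℕ.* 3)
invariant zero = invariant₃
invariant (suc zero) = invariant₆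
invariant (suc (suc zero)) = invariant₉
invariant (suc (suc (suc t))) = invariant-step (ℕ.m≤m+n 9 (t ℕ.* 3)) (invariant (suc (suc t)))

-- p′(1), by the product rule (c + x p)′ = p + x p′.
derivAt1 : Poly → ℤ
derivAt1 [] = + 0
derivAt1 (c ∷ p) = evalAt1 p + derivAt1 p

evalAt1-addP : ∀ p q → evalAt1 (addP p q) ≡ evalAt1 p + evalAt1 q
evalAt1-addP [] q = sym (ℤ.+-identityˡ _)
evalAt1-addP (a ∷ p) [] = sym (ℤ.+-identityʳ _)
evalAt1-addP (a ∷ p) (b ∷ q) = trans (cong (_+_ (a + b)) (evalAt1-addP p q)) (+-interchange a b (evalAt1 p) (evalAt1 q))

derivAt1-addP : ∀ p q → derivAt1 (addP p q) ≡ derivAt1 p + derivAt1 q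
derivAt1-addP [] q = sym (ℤ.+-identityˡ _)
derivAt1-addP (a ∷ p) [] = sym (ℤ.+-identityʳ _)
derivAt1-addP (a ∷ p) (b ∷ q) =
  trans (cong₂ _+_ (evalAt1-addP p q) (derivAt1-addP p q)) (+-interchange (evalAt1 p) (evalAt1 q) (derivAt1 p) (derivAt1 q))

evalAt1-monomial : ∀ c e → evalAt1 (monomial c e) ≡ c
evalAt1-monomial c zero = ℤ.+-identityʳ c
evalAt1-monomial c (suc e) = trans (ℤ.+-identityˡ _) (evalAt1-monomial c e)

derivAt1-monomial : ∀ c e → derivAt1 (monomial c e) ≡ + e * c
derivAt1-monomial c zero = sym (ℤ.*-zeroˡ c)
derivAt1-monomial c (suc e) =
  trans (cong₂ _+_ (evalAt1-monomial c e) (derivAt1-monomial c e))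
        (trans (cong (λ t → t + + e * c) (sym (ℤ.*-identityˡ c))) (trans (sym (ℤ.*-distribʳ-+ c (+ 1) (+ e))) (cong (_* c) (sym (ℤ.pos-+ 1 e)))))

evalAt1-sum : ∀ {A : Set} (h : A → Poly) xs → evalAt1 (foldr addP [] (map h xs)) ≡ sumBy (evalAt1 ∘ h) xs
evalAt1-sum h [] = refl
evalAt1-sum h (x ∷ xs) = trans (evalAt1-addP (h x) _) (cong (_+_ (evalAt1 (h x))) (evalAt1-sum h xs))

derivAt1-sum : ∀ {A : Set} (h : A → Poly) xs → derivAt1 (foldr addP [] (map h xs)) ≡ sumBy (derivAt1 ∘ h) xs
derivAt1-sum h [] = refl
derivAt1-sum h (x ∷ xs) = trans (derivAt1-addP (h x) _) (cong (_+_ (derivAt1 (h x))) (derivAt1-sum h xs))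

coeff-addP : ∀ p q i → coeff (addP p q) i ≡ coeff p i + coeff q i
coeff-addP [] q i = sym (ℤ.+-identityˡ _)
coeff-addP (a ∷ p) [] i = sym (ℤ.+-identityʳ _)
coeff-addP (a ∷ p) (b ∷ q) zero = refl
coeff-addP (a ∷ p) (b ∷ q) (suc i) = coeff-addP p q i

coeff-negP : ∀ q i → coeff (negP q) i ≡ - coeff q i
coeff-negP [] i = refl
coeff-negP (a ∷ q) zero = refl
coeff-negP (a ∷ q) (suc i) = coeff-negP q i

coeff-mulXm1 : ∀ q i → coeff (mulXm1 q) i ≡ coeff (+ 0 ∷ q) i - coeff q i
coeff-mulXm1 q i = trans (coeff-addP (+ 0 ∷ q) (negP q) i) (cong (_+_ (coeff (+ 0 ∷ q) i)) (coeff-negP q i))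

-- Synthetic division by x − 1, carrying the partial sum s of the coefficients already consumed:
-- the quotient coefficients are the negated partial sums.
divByX-1 : ℤ → Poly → Poly
divByX-1 s [] = []
divByX-1 s (c ∷ p) = - (s + c) ∷ divByX-1 (s + c) p

divByX-1-coeff : ∀ s p → s + evalAt1 p ≡ + 0 → ∀ i →
                 coeff p i ≡ coeff (- s ∷ divByX-1 s p) i - coeff (divByX-1 s p) i
divByX-1-coeff s [] s+0≡0 zero rewrite trans (sym (ℤ.+-identityʳ s)) s+0≡0 = refl
divByX-1-coeff s [] _ (suc i) = refl
divByX-1-coeff s (c ∷ p) _ zero = identity s c
  where identity : ∀ s c → c ≡ - s - - (s + c)
        identity = solve-∀
divByX-1-coeff s (c ∷ p) sum≡0 (suc i) = divByX-1-coeff (s + c) p (trans (ℤ.+-assoc s c _) sum≡0) i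

evalAt1-divByX-1 : ∀ s p → s + evalAt1 p ≡ + 0 → evalAt1 (divByX-1 s p) ≡ derivAt1 p
evalAt1-divByX-1 s [] _ = refl
evalAt1-divByX-1 s (c ∷ p) sum≡0 =
  cong₂ _+_ (trans (sym (ℤ.+-identityʳ (- (s + c)))) (trans (cong (_+_ (- (s + c))) (sym sum′≡0)) (identity (s + c) (evalAt1 p))))
            (evalAt1-divByX-1 (s + c) p sum′≡0)
  where
    sum′≡0 : s + c + evalAt1 p ≡ + 0
    sum′≡0 = trans (ℤ.+-assoc s c _) sum≡0
    identity : ∀ a e → - a + (a + e) ≡ e
    identity = solve-∀

rootMult1-one : ∀ p → evalAt1 p ≡ + 0 → derivAt1 p ≢ + 0 → RootMult1 p 1
rootMult1-one p p[1]≡0 p′[1]≢0 =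
  q , (λ i → trans (divByX-1-coeff (+ 0) p 0+p[1]≡0 i) (sym (coeff-mulXm1 q i))) ,
  (λ q[1]≡0 → p′[1]≢0 (trans (sym (evalAt1-divByX-1 (+ 0) p 0+p[1]≡0)) q[1]≡0))
  where
    q = divByX-1 (+ 0) p
    0+p[1]≡0 = trans (ℤ.+-identityˡ _) p[1]≡0

rootMult1-zero : ∀ p → evalAt1 p ≢ + 0 → RootMult1 p 0
rootMult1-zero p p[1]≢0 = p , (λ i → refl) , p[1]≢0

Unique-length : ∀ {n} {xs : List (Fin n)} → Unique xs → length xs ≤ n
Unique-length {zero} {[]} _ = z≤n
Unique-length {zero} {() ∷ _}
Unique-length {suc n} {[]} _ = z≤n
Unique-length {suc n} {x ∷ xs} (x∉xs ∷ uniq) =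
  s≤s (subst (_≤ n) (length-punchOuts x∉xs) (Unique-length (punchOuts-unique x∉xs uniq)))
  where
    punchOuts : ∀ {ys} → All (x ≢_) ys → List (Fin n)
    punchOuts [] = []
    punchOuts (x≢y ∷ x≢ys) = punchOut x≢y ∷ punchOuts x≢ys

    length-punchOuts : ∀ {ys} (x≢ys : All (x ≢_) ys) → length (punchOuts x≢ys) ≡ length ys
    length-punchOuts [] = refl
    length-punchOuts (_ ∷ x≢ys) = cong suc (length-punchOuts x≢ys)

    punchOuts-avoid : ∀ {y ys} (x≢y : x ≢ y) (x≢ys : All (x ≢_) ys) → All (y ≢_) ys →
                      All (punchOut x≢y ≢_) (punchOuts x≢ys)
    punchOuts-avoid x≢y [] [] = []
    punchOuts-avoid x≢y (x≢z ∷ x≢ys) (y≢z ∷ y≢ys) =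
      (y≢z ∘′ punchOut-injective x≢y x≢z) ∷ punchOuts-avoid x≢y x≢ys y≢ys

    punchOuts-unique : ∀ {ys} (x≢ys : All (x ≢_) ys) → Unique ys → Unique (punchOuts x≢ys)
    punchOuts-unique [] [] = []
    punchOuts-unique (x≢y ∷ x≢ys) (y≢ys ∷ uniq) = punchOuts-avoid x≢y x≢ys y≢ys ∷ punchOuts-unique x≢ys uniq

endpoints : ∀ {n} → List (Fin n × Fin n) → List (Fin n)
endpoints [] = []
endpoints ((a , b) ∷ es) = a ∷ b ∷ endpoints es

length-endpoints : ∀ {n} (es : List (Fin n × Fin n)) → length (endpoints es) ≡ 2 ℕ.* length es
length-endpoints [] = refl
length-endpoints (e ∷ es) = trans (cong (suc ∘ suc) (length-endpoints es)) (sym (ℕ.*-distribˡ-+ 2 1 (length es)))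

Loopless : ∀ {n} → Fin n × Fin n → Set
Loopless (a , b) = a ≢ b

private
  T-∧⁻ : ∀ x {y} → T (x ∧ y) → T x × T y
  T-∧⁻ true t = _ , t

  disjointEdges⇒≢ : ∀ {n} {a b c d : Fin n} → T (disjointEdges (a , b) (c , d)) → a ≢ c × a ≢ d × b ≢ c × b ≢ d
  disjointEdges⇒≢ {a = a} {b} {c} {d} disjoint with a Fin.≟ c | a Fin.≟ d | b Fin.≟ c | b Fin.≟ d
  ... | no a≢c | no a≢d | no b≢c | no b≢d = a≢c , a≢d , b≢c , b≢d
  ... | yes _ | _     | _     | _     = ⊥-elim disjoint
  ... | no _  | yes _ | _     | _     = ⊥-elim disjoint
  ... | no _  | no _  | yes _ | _     = ⊥-elim disjoint
  ... | no _  | no _  | no _  | yes _ = ⊥-elim disjoint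

  disjoint-endpoints : ∀ {n} (a b : Fin n) es → T (allB (disjointEdges (a , b)) es) →
                       All (a ≢_) (endpoints es) × All (b ≢_) (endpoints es)
  disjoint-endpoints a b [] _ = [] , []
  disjoint-endpoints a b ((c , d) ∷ es) all-disjoint
    with T-∧⁻ (disjointEdges (a , b) (c , d)) all-disjoint
  ... | disjoint , rest with disjointEdges⇒≢ disjoint | disjoint-endpoints a b es rest
  ... | a≢c , a≢d , b≢c , b≢d | a≢es , b≢es = (a≢c ∷ a≢d ∷ a≢es) , (b≢c ∷ b≢d ∷ b≢es)

matching-endpoints-unique : ∀ {n} (s : List (Fin n × Fin n)) → All Loopless s → T (isMatching s) → Unique (endpoints s)
matching-endpoints-unique [] _ _ = []
matching-endpoints-unique ((a , b) ∷ s) (a≢b ∷ loopless) matching with T-∧⁻ (allB (disjointEdges (a , b)) s) matching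
... | disjoint , matching′ with disjoint-endpoints a b s disjoint
... | a≢s , b≢s = (a≢b ∷ a≢s) ∷ b≢s ∷ matching-endpoints-unique s loopless matching′

matching-size : ∀ {n} (s : List (Fin n × Fin n)) → All Loopless s → T (isMatching s) → 2 ℕ.* length s ≤ n
matching-size s loopless matching =
  subst (_≤ _) (length-endpoints s) (Unique-length (matching-endpoints-unique s loopless matching))

isMatching≡pairwiseᵇ : ∀ {n} (s : List (Fin n × Fin n)) → isMatching s ≡ pairwiseᵇ disjointEdges s
isMatching≡pairwiseᵇ [] = refl
isMatching≡pairwiseᵇ (e ∷ s) = cong (allB (disjointEdges e) s ∧_) (isMatching≡pairwiseᵇ s)

sumBy-upTo-indicator : ∀ (c : ℕ → ℤ) j N → sumBy (λ k → if ⌊ j ℕ.≟ k ⌋ then c k else + 0) (upTo N) ≡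
                                             (if ⌊ j ℕ.<? N ⌋ then c j else + 0)
sumBy-upTo-indicator c j zero = refl
sumBy-upTo-indicator c j (suc N) =
  trans (cong (sumBy _) (sym (upTo-∷ʳ N)))
        (trans (sumBy-++ _ (upTo N) (N ∷ []))
               (trans (cong₂ _+_ (sumBy-upTo-indicator c j N) (ℤ.+-identityʳ _)) (last-step j N)))
  where
    last-step : ∀ j N → (if ⌊ j ℕ.<? N ⌋ then c j else + 0) + (if ⌊ j ℕ.≟ N ⌋ then c N else + 0) ≡
                        (if ⌊ j ℕ.<? suc N ⌋ then c j else + 0)
    last-step j N with j ℕ.<? N | j ℕ.≟ N | j ℕ.<? suc N
    ... | yes _ | no _ | yes _ = ℤ.+-identityʳ _
    ... | no _ | yes refl | yes _ = ℤ.+-identityˡ _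
    ... | no _ | no _ | no _ = refl
    ... | yes j<N | yes refl | _ = ⊥-elim (ℕ.<-irrefl refl j<N)
    ... | yes j<N | no _ | no j≮1+N = ⊥-elim (j≮1+N (ℕ.m<n⇒m<1+n j<N))
    ... | no _ | yes refl | no j≮1+j = ⊥-elim (j≮1+j ℕ.≤-refl)
    ... | no j≮N | no j≢N | yes j<1+N = ⊥-elim (j≮N (ℕ.≤∧≢⇒< (ℕ.≤-pred j<1+N) j≢N))

sumBy-countB : ∀ {A : Set} (c : ℕ → ℤ) K (m : List A → Bool) (L : List (List A)) →
  All (λ s → T (m s) → length s ≤ K) L →
  sumBy (λ k → c k * + countB (λ s → ⌊ length s ℕ.≟ k ⌋ ∧ m s) L) (upTo (suc K)) ≡
  sumBy (λ s → if m s then c (length s) else + 0) L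
sumBy-countB c K m [] [] = sumBy-zero (λ k → ℤ.*-zeroʳ (c k)) (upTo (suc K))
sumBy-countB c K m (s ∷ L) (bounded ∷ L-bounded) =
  trans (sumBy-cong (λ k → count-∷ (⌊ length s ℕ.≟ k ⌋ ∧ m s) (c k) _) (upTo (suc K)))
        (trans (sumBy-+ (λ k → if ⌊ length s ℕ.≟ k ⌋ ∧ m s then c k else + 0)
                        (λ k → c k * + countB (λ s → ⌊ length s ℕ.≟ k ⌋ ∧ m s) L) (upTo (suc K)))
               (cong₂ _+_ head (sumBy-countB c K m L L-bounded)))
  where
    count-∷ : ∀ b c n → c * + (if b then suc n else n) ≡ (if b then c else + 0) + c * + n
    count-∷ true c n = trans (cong (c *_) (ℤ.pos-+ 1 n)) (trans (ℤ.*-distribˡ-+ c (+ 1) (+ n)) (cong (_+ c * + n) (ℤ.*-identityʳ c)))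
    count-∷ false c n = sym (ℤ.+-identityˡ _)

    head : sumBy (λ k → if ⌊ length s ℕ.≟ k ⌋ ∧ m s then c k else + 0) (upTo (suc K)) ≡
           (if m s then c (length s) else + 0)
    head with m s
    ... | false = sumBy-zero (λ k → cong (λ b → if b then c k else + 0) (∧-zeroʳ ⌊ length s ℕ.≟ k ⌋)) (upTo (suc K))
    ... | true =
      trans (sumBy-cong (λ k → cong (λ b → if b then c k else + 0) (∧-identityʳ ⌊ length s ℕ.≟ k ⌋)) (upTo (suc K)))
            (trans (sumBy-upTo-indicator c (length s) (suc K))
                   (cong (λ b → if b then c (length s) else + 0)
                         (trans (isYes≗does (length s ℕ.<? suc K)) (dec-true (length s ℕ.<? suc K) (s≤s (bounded _))))))

half-bound : ∀ {l n} → 2 ℕ.* l ≤ n → l ≤ n ℕ./ 2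
half-bound {l} {n} 2l≤n = subst (_≤ n ℕ./ 2) (trans (cong (ℕ._/ 2) (ℕ.*-comm 2 l)) (m*n/n≡m l 2)) (/-monoˡ-≤ 2 2l≤n)

MatchingsFit : ∀ {n} → Graph n → Set
MatchingsFit {n} G = All (λ s → T (isMatching s) → 2 ℕ.* length s ≤ n) (sublists G)

module _ {n} (G : Graph n) (fit : MatchingsFit G) where

  private
    term : ℕ → Poly
    term k = monomial (sign k * + numMatchings G k) (n ℕ.∸ 2 ℕ.* k)

    countsOf : (ℕ → ℤ) → ℤ
    countsOf c = sumBy (λ k → c k * + numMatchings G k) (upTo (suc (n ℕ./ 2)))

    counts≡matchingSum : ∀ c → countsOf c ≡ sumBy (λ s → if isMatching s then c (length s) else + 0) (sublists G)
    counts≡matchingSum c = sumBy-countB c (n ℕ./ 2) isMatching (sublists G) (All.map (half-bound ∘_) fit)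

    isMatching-weight : ∀ c (s : List (Fin n × Fin n)) → (if isMatching s then c (length s) else + 0) ≡ matchingWeight disjointEdges c s
    isMatching-weight c s = cong (λ b → if b then c (length s) else + 0) (isMatching≡pairwiseᵇ s)

  evalAt1-matchingPoly : evalAt1 (matchingPoly G) ≡ matchingSum disjointEdges sign G
  evalAt1-matchingPoly = begin
    evalAt1 (matchingPoly G)
      ≡⟨ evalAt1-sum term (upTo (suc (n ℕ./ 2))) ⟩
    sumBy (λ k → evalAt1 (monomial (sign k * + numMatchings G k) (n ℕ.∸ 2 ℕ.* k))) (upTo (suc (n ℕ./ 2)))
      ≡⟨ sumBy-cong (λ k → evalAt1-monomial (sign k * + numMatchings G k) (n ℕ.∸ 2 ℕ.* k)) (upTo (suc (n ℕ./ 2))) ⟩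
    countsOf sign
      ≡⟨ counts≡matchingSum sign ⟩
    sumBy (λ s → if isMatching s then sign (length s) else + 0) (sublists G)
      ≡⟨ sumBy-cong (isMatching-weight sign) (sublists G) ⟩
    matchingSum disjointEdges sign G ∎
    where open ≡-Reasoning

  derivAt1-matchingPoly : derivAt1 (matchingPoly G) ≡
                          + n * matchingSum disjointEdges sign G - + 2 * matchingSum disjointEdges signedSize G
  derivAt1-matchingPoly = begin
    derivAt1 (matchingPoly G)
      ≡⟨ derivAt1-sum term (upTo (suc (n ℕ./ 2))) ⟩
    sumBy (λ k → derivAt1 (monomial (sign k * + numMatchings G k) (n ℕ.∸ 2 ℕ.* k))) (upTo (suc (n ℕ./ 2)))
      ≡⟨ sumBy-cong (λ k → trans (derivAt1-monomial (sign k * + numMatchings G k) (n ℕ.∸ 2 ℕ.* k)) (sym (ℤ.*-assoc (+ (n ℕ.∸ 2 ℕ.* k)) (sign k) _)))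
                    (upTo (suc (n ℕ./ 2))) ⟩
    countsOf (λ k → + (n ℕ.∸ 2 ℕ.* k) * sign k)
      ≡⟨ counts≡matchingSum (λ k → + (n ℕ.∸ 2 ℕ.* k) * sign k) ⟩
    sumBy (λ s → if isMatching s then + (n ℕ.∸ 2 ℕ.* length s) * sign (length s) else + 0) (sublists G)
      ≡⟨ sumBy-cong-All truncation-free fit ⟩
    matchingSum disjointEdges (λ k → + n * sign k + - + 2 * signedSize k) G
      ≡⟨ matchingSum-+ disjointEdges {h = λ k → + n * sign k} {h' = λ k → - + 2 * signedSize k} (λ _ → refl) G ⟩
    matchingSum disjointEdges (λ k → + n * sign k) G + matchingSum disjointEdges (λ k → - + 2 * signedSize k) G
      ≡⟨ cong₂ _+_ (matchingSum-* disjointEdges (+ n) {h = sign} (λ _ → refl) G)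
                   (trans (matchingSum-* disjointEdges (- + 2) {h = signedSize} (λ _ → refl) G) (sym (ℤ.neg-distribˡ-* (+ 2) _))) ⟩
    + n * matchingSum disjointEdges sign G - + 2 * matchingSum disjointEdges signedSize G ∎
    where
      open ≡-Reasoning
      weight : ℕ → ℤ
      weight k = + n * sign k + - + 2 * signedSize k
      -- n ∸ 2|s| is truncated subtraction; it agrees with n − 2|s| because matchings fit.
      truncation-free : ∀ s → (T (isMatching s) → 2 ℕ.* length s ≤ n) →
        (if isMatching s then + (n ℕ.∸ 2 ℕ.* length s) * sign (length s) else + 0) ≡ matchingWeight disjointEdges weight s
      truncation-free s fits with isMatching s | isMatching≡pairwiseᵇ s
      ... | false | pairwise≡ = cong (λ b → if b then weight (length s) else + 0) pairwise≡
      ... | true | pairwise≡ = trans (coefficient (length s) (fits _)) (cong (λ b → if b then weight (length s) else + 0) pairwise≡)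
        where
          identity : ∀ N L s → (N - + 2 * L) * s ≡ N * s + - + 2 * (s * L)
          identity = solve-∀
          coefficient : ∀ l → 2 ℕ.* l ≤ n → + (n ℕ.∸ 2 ℕ.* l) * sign l ≡ + n * sign l + - + 2 * signedSize l
          coefficient l 2l≤n = trans (cong (_* sign l) (trans (sym (ℤ.⊖-≥ 2l≤n)) (trans (sym (ℤ.m-n≡m⊖n n (2 ℕ.* l)))
                                                                  (cong (λ t → + n - t) (ℤ.pos-* 2 l)))))
                                     (identity (+ n) (+ l) (sign l))

⌊⌋-⇔ : ∀ {A B : Set} → A ⇔ B → (a? : Dec A) (b? : Dec B) → ⌊ a? ⌋ ≡ ⌊ b? ⌋
⌊⌋-⇔ A⇔B a? b? = trans (isYes≗does a?) (trans (does-⇔ A⇔B a? b?) (sym (isYes≗does b?)))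

toℕ-toFin : ∀ m a → a ≤ m → toℕ (toFin m a) ≡ a
toℕ-toFin zero zero _ = refl
toℕ-toFin (suc m) zero _ = refl
toℕ-toFin (suc m) (suc a) (s≤s a≤m) = cong suc (toℕ-toFin m a a≤m)

toFin-toℕ : ∀ m (u : Fin (suc m)) → toFin m (toℕ u) ≡ u
toFin-toℕ zero Fin.zero = refl
toFin-toℕ (suc m) Fin.zero = refl
toFin-toℕ (suc m) (Fin.suc u) = cong Fin.suc (toFin-toℕ m u)

Bounded : ℕ → Edge → Set
Bounded m (a , b) = a ≤ m × b ≤ m

toFinᵉ : ∀ m → Edge → Fin (suc m) × Fin (suc m)
toFinᵉ m (a , b) = toFin m a , toFin m b

toFin-== : ∀ m {a c} → a ≤ m → c ≤ m → (toFin m a == toFin m c) ≡ (a ℕ.≡ᵇ c)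
toFin-== m {a} {c} a≤m c≤m =
  trans (isYes≗does (toFin m a Fin.≟ toFin m c))
        (does-⇔ (mk⇔ (λ eq → trans (sym (toℕ-toFin m a a≤m)) (trans (cong toℕ eq) (toℕ-toFin m c c≤m))) (cong (toFin m)))
                (toFin m a Fin.≟ toFin m c) (a ℕ.≟ c))

==-toFin : ∀ m (u : Fin (suc m)) {a} → a ≤ m → (u == toFin m a) ≡ (toℕ u ℕ.≡ᵇ a)
==-toFin m u {a} a≤m =
  trans (isYes≗does (u Fin.≟ toFin m a))
        (does-⇔ (mk⇔ (λ eq → trans (cong toℕ eq) (toℕ-toFin m a a≤m)) (λ eq → trans (sym (toFin-toℕ m u)) (cong (toFin m) eq)))
                (u Fin.≟ toFin m a) (toℕ u ℕ.≟ a))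

disjointEdges-toFin : ∀ m {e f} → Bounded m e → Bounded m f → disjointEdges (toFinᵉ m e) (toFinᵉ m f) ≡ disjoint e f
disjointEdges-toFin m {a , b} {c , d} (a≤m , b≤m) (c≤m , d≤m)
  rewrite toFin-== m a≤m c≤m | toFin-== m a≤m d≤m | toFin-== m b≤m c≤m | toFin-== m b≤m d≤m =
  sym (∧-assoc (not (a ℕ.≡ᵇ c)) (not (a ℕ.≡ᵇ d)) _)

matchingSum-toFin : ∀ m g {E} → All (Bounded m) E → matchingSum disjointEdges g (map (toFinᵉ m) E) ≡ matchingSum disjoint g E
matchingSum-toFin m = matchingSum-map disjoint disjointEdges (toFinᵉ m) (disjointEdges-toFin m)

avoidsᶠ : ∀ {n} → Fin n → Fin n × Fin n → Bool
avoidsᶠ u (a , b) = not (u == a) ∧ not (u == b)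

Renumbered : ∀ {n} → Fin (suc n) → Fin (suc n) × Fin (suc n) → Fin n × Fin n → Set
Renumbered u (a , b) (a′ , b′) = Σ (u ≢ a) (λ u≢a → a′ ≡ punchOut u≢a) × Σ (u ≢ b) (λ u≢b → b′ ≡ punchOut u≢b)

deleteVertex-pointwise : ∀ {n} (G : Graph (suc n)) u → Pointwise (Renumbered u) (filterᵇ (avoidsᶠ u) G) (deleteVertex G u)
deleteVertex-pointwise [] u = []
deleteVertex-pointwise ((a , b) ∷ es) u with u Fin.≟ a | u Fin.≟ b
... | yes _ | _ = deleteVertex-pointwise es u
... | no _ | yes _ = deleteVertex-pointwise es u
... | no u≢a | no u≢b = ((u≢a , refl) , (u≢b , refl)) ∷ deleteVertex-pointwise es u

punchOut-== : ∀ {n} {u a c : Fin (suc n)} (u≢a : u ≢ a) (u≢c : u ≢ c) → (punchOut u≢a == punchOut u≢c) ≡ (a == c)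
punchOut-== {u = u} {a} {c} u≢a u≢c =
  ⌊⌋-⇔ (mk⇔ (punchOut-injective u≢a u≢c) (punchOut-cong u)) (punchOut u≢a Fin.≟ punchOut u≢c) (a Fin.≟ c)

disjointEdges-renumbered : ∀ {n} (u : Fin (suc n)) {e e′ f f′} → Renumbered u e e′ → Renumbered u f f′ →
                           disjointEdges e f ≡ disjointEdges e′ f′
disjointEdges-renumbered u ((u≢a , refl) , (u≢b , refl)) ((u≢c , refl) , (u≢d , refl))
  rewrite punchOut-== u≢a u≢c | punchOut-== u≢a u≢d | punchOut-== u≢b u≢c | punchOut-== u≢b u≢d = refl

matchingSum-deleteVertex : ∀ {n} (G : Graph (suc n)) u g →
  matchingSum disjointEdges g (deleteVertex G u) ≡ matchingSum disjointEdges g (filterᵇ (avoidsᶠ u) G)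
matchingSum-deleteVertex G u g =
  sym (matchingSum-pointwise disjointEdges disjointEdges (disjointEdges-renumbered u) g (deleteVertex-pointwise G u))

sublists-All : ∀ {A : Set} {P : A → Set} {xs} → All P xs → All (All P) (sublists xs)
sublists-All [] = [] ∷ []
sublists-All (px ∷ pxs) = ++⁺ (sublists-All pxs) (map⁺ (All.map (px ∷_) (sublists-All pxs)))

matchingsFit : ∀ {n} (G : Graph n) → All Loopless G → MatchingsFit G
matchingsFit G loopless = All.map (λ {s} s-loopless → matching-size s s-loopless) (sublists-All loopless)

deleteVertex-loopless : ∀ {n} (G : Graph (suc n)) u → All Loopless G → All Loopless (deleteVertex G u)
deleteVertex-loopless G u loopless = renumber (deleteVertex-pointwise G u) (filter⁺ _ loopless)
  where
    renumber : ∀ {es es′} → Pointwise (Renumbered u) es es′ → All Loopless es → All Loopless es′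
    renumber [] [] = []
    renumber (((u≢a , refl) , (u≢b , refl)) ∷ rs) (a≢b ∷ ls) = (a≢b ∘ punchOut-injective u≢a u≢b) ∷ renumber rs ls

avoidsᶠ-toFin : ∀ m (u : Fin (suc m)) {e} → Bounded m e → avoidsᶠ u (toFinᵉ m e) ≡ avoids (toℕ u) e
avoidsᶠ-toFin m u (a≤m , b≤m) = cong₂ (λ x y → not x ∧ not y) (==-toFin m u a≤m) (==-toFin m u b≤m)

filterᵇ-avoidsᶠ-toFin : ∀ m (u : Fin (suc m)) {E} → All (Bounded m) E →
                        filterᵇ (avoidsᶠ u) (map (toFinᵉ m) E) ≡ map (toFinᵉ m) (E ∖ toℕ u)
filterᵇ-avoidsᶠ-toFin m u {E} bounded =
  trans (filterᵇ-map (avoidsᶠ u) (toFinᵉ m) E) (cong (map (toFinᵉ m)) (filterᵇ-cong-All (λ e → avoidsᶠ-toFin m u) bounded))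

ProperEdge : ℕ → Edge → Set
ProperEdge m e = Bounded m e × proj₁ e ≢ proj₂ e

path-proper : ∀ m s L → s ℕ.+ L ≤ m → All (ProperEdge m) (path s L)
path-proper m s zero _ = []
path-proper m s (suc L) s+1+L≤m =
  ((ℕ.≤-trans (ℕ.m≤m+n s (suc L)) s+1+L≤m , ℕ.≤-trans (s≤s (ℕ.m≤m+n s L)) s+1+L≤′m) , ℕ.<⇒≢ (ℕ.n<1+n s))
  ∷ path-proper m (suc s) L s+1+L≤′m
  where s+1+L≤′m = subst (_≤ m) (ℕ.+-suc s L) s+1+L≤m

pendants-proper : ∀ P → All (ProperEdge (7 ℕ.+ P)) (pendants P)
pendants-proper P =
  at 1 2 (from-yes (1 ℕ.<? 2)) (from-yes (2 ℕ.≤? 7)) ∷ at 1 3 (from-yes (1 ℕ.<? 3)) (from-yes (3 ℕ.≤? 7)) ∷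
  at 2 4 (from-yes (2 ℕ.<? 4)) (from-yes (4 ℕ.≤? 7)) ∷ at 2 5 (from-yes (2 ℕ.<? 5)) (from-yes (5 ℕ.≤? 7)) ∷
  at-last 5 (from-yes (6 ℕ.≤? 7)) ∷ at-last 6 ℕ.≤-refl ∷ []
  where
    at : ∀ v j → v < j → j ≤ 7 → ProperEdge (7 ℕ.+ P) (v , j ℕ.+ P)
    at v j v<j j≤7 = (ℕ.≤-trans (ℕ.<⇒≤ v<j) (ℕ.≤-trans j≤7 (ℕ.m≤m+n 7 P)) , ℕ.+-monoˡ-≤ P j≤7) ,
                     ℕ.<⇒≢ (ℕ.<-≤-trans v<j (ℕ.m≤m+n j P))
    at-last : ∀ j → suc j ≤ 7 → ProperEdge (7 ℕ.+ P) (P , suc j ℕ.+ P)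
    at-last j 1+j≤7 = (ℕ.m≤n+m P 7 , ℕ.+-monoˡ-≤ P 1+j≤7) , ℕ.m≢1+n+m P

F⋆-proper : ∀ P → All (ProperEdge (7 ℕ.+ P)) (F⋆ P)
F⋆-proper P = subst (All _) (sym (F⋆-path-pendants P))
                    (++⁺ (path-proper (7 ℕ.+ P) 0 (suc P) (ℕ.m≤n+m (suc P) 6)) (pendants-proper P))

module _ (P : ℕ) where

  private
    m = 7 ℕ.+ P
    G = Fstar (suc m)
    bounded = All.map proj₁ (F⋆-proper P)

    loopless : All Loopless G
    loopless = gmap⁺ (λ {e} → toFin-loopless e) (F⋆-proper P)
      where
        toFin-loopless : ∀ e → ProperEdge m e → Loopless (toFinᵉ m e)
        toFin-loopless (a , b) ((a≤m , b≤m) , a≢b) eq = a≢b (trans (sym (toℕ-toFin m a a≤m)) (trans (cong toℕ eq) (toℕ-toFin m b b≤m)))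

  evalAt1-F⋆ : evalAt1 (matchingPoly G) ≡ μ₁ (F⋆ P)
  evalAt1-F⋆ = trans (evalAt1-matchingPoly G (matchingsFit G loopless)) (matchingSum-toFin m sign bounded)

  derivAt1-F⋆ : derivAt1 (matchingPoly G) ≡ + (8 ℕ.+ P) * μ₁ (F⋆ P) - + 2 * ν₁ (F⋆ P)
  derivAt1-F⋆ = trans (derivAt1-matchingPoly G (matchingsFit G loopless))
                      (cong₂ (λ x y → + (8 ℕ.+ P) * x - + 2 * y) (matchingSum-toFin m sign bounded) (matchingSum-toFin m signedSize bounded))

  evalAt1-F⋆∖ : ∀ u → evalAt1 (matchingPoly (deleteVertex G u)) ≡ μ₁ (F⋆ P ∖ toℕ u)
  evalAt1-F⋆∖ u = begin
    evalAt1 (matchingPoly (deleteVertex G u))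
      ≡⟨ evalAt1-matchingPoly (deleteVertex G u) (matchingsFit _ (deleteVertex-loopless G u loopless)) ⟩
    matchingSum disjointEdges sign (deleteVertex G u)
      ≡⟨ matchingSum-deleteVertex G u sign ⟩
    matchingSum disjointEdges sign (filterᵇ (avoidsᶠ u) G)
      ≡⟨ cong (matchingSum disjointEdges sign) (filterᵇ-avoidsᶠ-toFin m u bounded) ⟩
    matchingSum disjointEdges sign (map (toFinᵉ m) (F⋆ P ∖ toℕ u))
      ≡⟨ matchingSum-toFin m sign (filter⁺ (T? ∘ avoids (toℕ u)) bounded) ⟩
    μ₁ (F⋆ P ∖ toℕ u) ∎
    where open ≡-Reasoning

F⋆-one-critical : ∀ {P} → Invariant P → OneCritical (Fstar (8 ℕ.+ P))
F⋆-one-critical {P} inv =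
  0 , rootMult1-one (matchingPoly (Fstar (8 ℕ.+ P))) (trans (evalAt1-F⋆ P) μ₁-vanishes) simple-root ,
  λ u → rootMult1-zero (matchingPoly (deleteVertex (Fstar (8 ℕ.+ P)) u)) (deleted-nonroot u)
  where
    open Invariant inv
    ν₁≢0 : ν₁ (F⋆ P) ≢ + 0
    ν₁≢0 ν₁≡0 = ℤ.<-irrefl (trans (cong (ε *_) ν₁≡0) (ℤ.*-zeroʳ ε)) ν₁-negative
    simple-root : derivAt1 (matchingPoly (Fstar (8 ℕ.+ P))) ≢ + 0
    simple-root deriv≡0 = ν₁≢0 (ℤ.*-cancelˡ-≡ (+ 2) (ν₁ (F⋆ P)) (+ 0) (ℤ.neg-injective (begin
      - (+ 2 * ν₁ (F⋆ P))                                   ≡⟨ sym (ℤ.+-identityˡ _) ⟩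
      + 0 - + 2 * ν₁ (F⋆ P)                                 ≡⟨ cong (λ x → x - + 2 * ν₁ (F⋆ P)) (sym (ℤ.*-zeroʳ (+ (8 ℕ.+ P)))) ⟩
      + (8 ℕ.+ P) * + 0 - + 2 * ν₁ (F⋆ P)                   ≡⟨ cong (λ x → + (8 ℕ.+ P) * x - + 2 * ν₁ (F⋆ P)) (sym μ₁-vanishes) ⟩
      + (8 ℕ.+ P) * μ₁ (F⋆ P) - + 2 * ν₁ (F⋆ P)             ≡⟨ sym (derivAt1-F⋆ P) ⟩
      derivAt1 (matchingPoly (Fstar (8 ℕ.+ P)))             ≡⟨ deriv≡0 ⟩
      + 0                                                   ∎)))
      where open ≡-Reasoning
    deleted-nonroot : ∀ u → evalAt1 (matchingPoly (deleteVertex (Fstar (8 ℕ.+ P)) u)) ≢ + 0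
    deleted-nonroot u root =
      ℤ.<-irrefl (sym (trans (cong (ε *_) (trans (sym (evalAt1-F⋆∖ P u)) root)) (ℤ.*-zeroʳ ε)))
                 (μ₁-∖-positive (toℕ u) (toℕ<n u))

≡2-mod-3 : ∀ m → 11 ≤ suc m → suc m % 3 ≡ 2 → Σ ℕ λ t → m ≡ 7 ℕ.+ (3 ℕ.+ t ℕ.* 3)
≡2-mod-3 m 11≤1+m 1+m%3≡2 = q ℕ.∸ 3 , ℕ.suc-injective (begin
    suc m                                ≡⟨ 1+m≡2+q*3 ⟩
    2 ℕ.+ q ℕ.* 3                        ≡⟨ cong (λ x → 2 ℕ.+ x ℕ.* 3) (sym (ℕ.m+[n∸m]≡n 3≤q)) ⟩
    2 ℕ.+ (3 ℕ.+ (q ℕ.∸ 3)) ℕ.* 3        ∎)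
  where
    open ≡-Reasoning
    q = suc m ℕ./ 3
    1+m≡2+q*3 : suc m ≡ 2 ℕ.+ q ℕ.* 3
    1+m≡2+q*3 = trans (m≡m%n+[m/n]*n (suc m) 3) (cong (ℕ._+ q ℕ.* 3) 1+m%3≡2)
    3≤q : 3 ≤ q
    3≤q = ℕ.≮⇒≥ λ q<3 →
      let 1+m≤8 = ℕ.≤-trans (ℕ.≤-reflexive 1+m≡2+q*3) (ℕ.+-monoʳ-≤ 2 (ℕ.*-monoˡ-≤ 3 (ℕ.≤-pred q<3)))
      in ℕ.<⇒≱ (ℕ.≤-<-trans 1+m≤8 (from-yes (8 ℕ.<? 11))) 11≤1+m

proposition5p6 : (m : ℕ) → 11 ≤ suc m → suc m % 3 ≡ 2 → OneCritical (Fstar (suc m))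
proposition5p6 m 11≤1+m 1+m%3≡2 with t , refl ← ≡2-mod-3 m 11≤1+m 1+m%3≡2 = F⋆-one-critical (invariant t)
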